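{- Let $R \cong R_1 \times R_2 \times \cdots \times R_n$ with $n \ge 2$, where each $R_i$ is a local commutative ring with unity with maximal ideal $\mathcal{M}_i$. Then $\mathrm{PIS}(R)$ is a cactus graph if and only if $R \cong F_1 \times R_2$, where $F_1$ is a field and $R_2$ is a local ring with $\mathcal{I}^*(R_2) = \{\mathcal{M}_2\}$.
   Context: For a commutative ring $R$ with unity, $\mathcal{I}^*(R)$ denotes the set of nonzero proper ideals of $R$. The prime ideal sum graph $\mathrm{PIS}(R)$ is the simple undirected graph with vertex set $\mathcal{I}^*(R)$, two distinct vertices $I, J$ adjacent if and only if $I+J$ is a prime ideal of $R$. A cactus graph is a connected graph in which any two simple cycles have at most one vertex in common. -}

module Defs where

open import Level using (Level; _⊔_) renaming (suc to lsuc)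
open import Algebra.Bundles using (CommutativeRing)
open import Algebra.Morphism.Structures using (module RingMorphisms)
open import Algebra.Construct.DirectProduct using () renaming (commutativeRing to _×ᴿ_)
open import Data.Nat using (ℕ; suc)
open import Data.Nat.DivMod using (_%_; m%n<n)
open import Data.Fin using (Fin; toℕ; fromℕ<)
open import Data.Product using (Σ; ∃; _×_; _,_; proj₁; proj₂)
open import Data.Sum using (_⊎_)
open import Relation.Nullary using (¬_)
open import Relation.Binary.PropositionalEquality using (_≡_)
import Algebra.Properties.CommutativeSemigroup as CSP

module _ {c ℓ : Level} (R : CommutativeRing c ℓ) where
  open CommutativeRing R

  record Ideal : Set (lsuc (c ⊔ ℓ)) where
    field
      _∈I      : Carrier → Set (c ⊔ ℓ)
      ∈-resp-≈ : ∀ {x y} → x ≈ y → x ∈I → y ∈I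
      0∈       : 0# ∈I
      +-closed : ∀ {x y} → x ∈I → y ∈I → (x + y) ∈I
      *-closed : ∀ r {x} → x ∈I → (r * x) ∈I
  open Ideal public

  _⊆I_ : Ideal → Ideal → Set (c ⊔ ℓ)
  I ⊆I J = ∀ x → (I ∈I) x → (J ∈I) x

  _≐_ : Ideal → Ideal → Set (c ⊔ ℓ)
  I ≐ J = (I ⊆I J) × (J ⊆I I)

  Proper : Ideal → Set (c ⊔ ℓ)
  Proper I = ¬ ((I ∈I) 1#)

  NonZeroIdeal : Ideal → Set (c ⊔ ℓ)
  NonZeroIdeal I = Σ Carrier λ x → (I ∈I) x × ¬ (x ≈ 0#)

  IsPrime : Ideal → Set (c ⊔ ℓ)
  IsPrime P = Proper P × (∀ a b → (P ∈I) (a * b) → (P ∈I) a ⊎ (P ∈I) b)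

  IsMaximal : Ideal → Set (lsuc (c ⊔ ℓ))
  IsMaximal M = Proper M × (∀ J → M ⊆I J → Proper J → J ⊆I M)

  IsLocal : Set (lsuc (c ⊔ ℓ))
  IsLocal = Σ Ideal λ M → IsMaximal M × (∀ N → IsMaximal N → N ≐ M)

  IsField : Set (c ⊔ ℓ)
  IsField = ¬ (1# ≈ 0#) × (∀ x → ¬ (x ≈ 0#) → Σ Carrier λ y → x * y ≈ 1#)

  _⊕_ : Ideal → Ideal → Ideal
  I ⊕ J = record
    { _∈I = λ z → Σ Carrier λ a → Σ Carrier λ b → (I ∈I) a × (J ∈I) b × z ≈ a + b
    ; ∈-resp-≈ = λ { x≈y (a , b , a∈ , b∈ , e) → a , b , a∈ , b∈ , trans (sym x≈y) e }
    ; 0∈ = 0# , 0# , 0∈ I , 0∈ J , sym (+-identityˡ 0#)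
    ; +-closed = λ { (a , b , a∈ , b∈ , e) (a' , b' , a'∈ , b'∈ , e') →
        a + a' , b + b' , +-closed I a∈ a'∈ , +-closed J b∈ b'∈ ,
        trans (+-cong e e') (CSP.interchange +-commutativeSemigroup a b a' b') }
    ; *-closed = λ { r (a , b , a∈ , b∈ , e) →
        r * a , r * b , *-closed I r a∈ , *-closed J r b∈ ,
        trans (*-congˡ e) (distribˡ r a b) }
    }

  Vertex : Set (lsuc (c ⊔ ℓ))
  Vertex = Σ Ideal λ I → NonZeroIdeal I × Proper I

  OnlyNonzeroProperIdeal : Ideal → Set (lsuc (c ⊔ ℓ))
  OnlyNonzeroProperIdeal M =
    NonZeroIdeal M × Proper M × (∀ I → NonZeroIdeal I → Proper I → I ≐ M)

record Graph (v e : Level) : Set (lsuc (v ⊔ e)) where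
  field
    V    : Set v
    _≃_  : V → V → Set e
    Adj  : V → V → Set e

next : ∀ {n} → Fin (suc n) → Fin (suc n)
next {n} i = fromℕ< (m%n<n (suc (toℕ i)) (suc n))

module _ {v e : Level} (G : Graph v e) where
  open Graph G

  data Walk : V → V → Set (v ⊔ e) where
    stop : ∀ {x y} → x ≃ y → Walk x y
    step : ∀ {x y z} → Adj x y → Walk y z → Walk x z

  Connected : Set (v ⊔ e)
  Connected = ∀ x y → Walk x y

  -- a simple cycle of length k+3: vertices C 0, …, C (k+2), pairwise
  -- distinct, with C i adjacent to C (i+1 mod k+3)
  record Cycle : Set (v ⊔ e) where
    field
      len      : ℕ
      vtx      : Fin (suc (suc (suc len))) → V
      distinct : ∀ i j → vtx i ≃ vtx j → i ≡ j
      adjacent : ∀ i → Adj (vtx i) (vtx (next i))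
  open Cycle public

  OnCycle : Cycle → V → Set e
  OnCycle C x = Σ (Fin (suc (suc (suc (len C))))) λ i → x ≃ vtx C i

  EdgeOf : Cycle → V → V → Set e
  EdgeOf C x y = Σ (Fin (suc (suc (suc (len C))))) λ i →
    (x ≃ vtx C i × y ≃ vtx C (next i)) ⊎ (y ≃ vtx C i × x ≃ vtx C (next i))

  -- two cycles are the same cycle (subgraph) iff they have the same edges
  SameCycle : Cycle → Cycle → Set (v ⊔ e)
  SameCycle C D = ∀ x y → (EdgeOf C x y → EdgeOf D x y) × (EdgeOf D x y → EdgeOf C x y)

  IsCactus : Set (v ⊔ e)
  IsCactus = Connected ×
    (∀ C D → ¬ SameCycle C D →
       ∀ x y → OnCycle C x → OnCycle D x → OnCycle C y → OnCycle D y → x ≃ y)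

PIS : ∀ {c ℓ} (R : CommutativeRing c ℓ) → Graph (lsuc (c ⊔ ℓ)) (c ⊔ ℓ)
PIS R = record
  { V   = Vertex R
  ; _≃_ = λ I J → _≐_ R (proj₁ I) (proj₁ J)
  ; Adj = λ I J → ¬ (_≐_ R (proj₁ I) (proj₁ J)) × IsPrime R (_⊕_ R (proj₁ I) (proj₁ J))
  }

_≅ᴿ_ : ∀ {a b ℓ₁ ℓ₂} → CommutativeRing a ℓ₁ → CommutativeRing b ℓ₂ → Set (a ⊔ b ⊔ ℓ₁ ⊔ ℓ₂)
R ≅ᴿ S = Σ (CommutativeRing.Carrier R → CommutativeRing.Carrier S) λ f →
  RingMorphisms.IsRingIsomorphism (CommutativeRing.rawRing R) (CommutativeRing.rawRing S) f

module _ {c ℓ : Level} {n : ℕ} (Rs : Fin n → CommutativeRing c ℓ) where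
  private
    module Rᵢ (i : Fin n) = CommutativeRing (Rs i)
    C : Set c
    C = (i : Fin n) → Rᵢ.Carrier i
    _≈_ : C → C → Set ℓ
    x ≈ y = ∀ i → Rᵢ._≈_ i (x i) (y i)

  Πᴿ : CommutativeRing c ℓ
  Πᴿ = record
    { Carrier = C
    ; _≈_ = _≈_
    ; _+_ = λ x y i → Rᵢ._+_ i (x i) (y i)
    ; _*_ = λ x y i → Rᵢ._*_ i (x i) (y i)
    ; -_ = λ x i → Rᵢ.-_ i (x i)
    ; 0# = λ i → Rᵢ.0# i
    ; 1# = λ i → Rᵢ.1# i
    ; isCommutativeRing = record
      { isRing = record
        { +-isAbelianGroup = record
          { isGroup = record
            { isMonoid = record
              { isSemigroup = record
                { isMagma = record
                  { isEquivalence = record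
                    { refl = λ i → Rᵢ.refl i
                    ; sym = λ p i → Rᵢ.sym i (p i)
                    ; trans = λ p q i → Rᵢ.trans i (p i) (q i) }
                  ; ∙-cong = λ p q i → Rᵢ.+-cong i (p i) (q i) }
                ; assoc = λ x y z i → Rᵢ.+-assoc i (x i) (y i) (z i) }
              ; identity = (λ x i → Rᵢ.+-identityˡ i (x i)) , (λ x i → Rᵢ.+-identityʳ i (x i)) }
            ; inverse = (λ x i → Rᵢ.-‿inverseˡ i (x i)) , (λ x i → Rᵢ.-‿inverseʳ i (x i))
            ; ⁻¹-cong = λ p i → Rᵢ.-‿cong i (p i) }
          ; comm = λ x y i → Rᵢ.+-comm i (x i) (y i) }
        ; *-cong = λ p q i → Rᵢ.*-cong i (p i) (q i)
        ; *-assoc = λ x y z i → Rᵢ.*-assoc i (x i) (y i) (z i)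
        ; *-identity = (λ x i → Rᵢ.*-identityˡ i (x i)) , (λ x i → Rᵢ.*-identityʳ i (x i))
        ; distrib = (λ x y z i → Rᵢ.distribˡ i (x i) (y i) (z i)) , (λ x y z i → Rᵢ.distribʳ i (x i) (y i) (z i)) }
      ; *-comm = λ x y i → Rᵢ.*-comm i (x i) (y i) }
    }

-- Ideals of R ≅ R₁ × ⋯ × Rₙ are products of ideals of the factors, and such a product is prime
-- exactly when it is a prime ideal in one coordinate and the whole ring in all the others. For
-- n ≥ 3, and for n = 2 unless the ring is a field F times a local ring S whose only nonzero proper
-- ideal is its maximal ideal M, this yields two triangles of PIS(R) sharing an edge, which a cactus
-- forbids; when both factors are fields, F₁ × 0 is an isolated vertex. Conversely, PIS(F × S) has,
-- up to equality of ideals, the four vertices F × 0, 0 × M, F × M, 0 × S: a triangle with the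
-- pendant edge 0 × M — 0 × S, so it is connected and its only cycle is that triangle.

module Submission where

open import Defs
open import Level using (Level; _⊔_; Lift; lift; lower)
import Level
open import Algebra.Bundles using (CommutativeRing)
open import Algebra.Construct.DirectProduct using () renaming (commutativeRing to _×ᴿ_)
import Algebra.Morphism.Construct.Composition as Composition
open import Algebra.Morphism.Structures using (module RingMorphisms)
open import Axiom.DoubleNegationElimination using (em⇒dne)
open import Axiom.ExcludedMiddle using (ExcludedMiddle)
open import Data.Bool using (Bool; true; false; _∨_; T)
open import Data.Empty using (⊥; ⊥-elim)
open import Data.Fin using (Fin; zero; suc)
import Data.Fin as Fin
open import Data.Fin.Properties using (all?; pigeonhole; <-irrefl)
open import Data.Nat using (ℕ; _≤_)
import Data.Nat as ℕ
import Data.Nat.Properties as ℕ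
open import Data.Product using (Σ; _×_; _,_; proj₁; proj₂; swap)
open import Data.Sum using (_⊎_; inj₁; inj₂)
import Data.Sum as Sum
open import Data.Unit.Polymorphic using (⊤; tt)
open import Function.Bundles using (_⇔_; mk⇔; Equivalence)
open import Relation.Binary.PropositionalEquality using (_≡_; _≢_)
import Relation.Binary.PropositionalEquality as ≡
open import Relation.Nullary using (¬_; yes; no)
open import Relation.Nullary.Decidable using (map′; from-yes; ¬?; _→-dec_; _×-dec_; _⊎-dec_; T?)

lowerEM : ∀ {a} b → ExcludedMiddle (a ⊔ b) → ExcludedMiddle a
lowerEM b em {P} = map′ lower lift (em {Lift b P})

-- Ideals are passed explicitly throughout: _⊆I_ and _≐_ unfold to function types, from which
-- Agda cannot infer them.
module IdealLattice {c ℓ : Level} (R : CommutativeRing c ℓ) where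
  open CommutativeRing R

  infix 4 _⊆_ _≈ᴵ_
  infixl 6 _+ᴵ_

  _⊆_ _≈ᴵ_ : Ideal R → Ideal R → Set (c ⊔ ℓ)
  _⊆_ = _⊆I_ R
  _≈ᴵ_ = _≐_ R

  _+ᴵ_ : Ideal R → Ideal R → Ideal R
  _+ᴵ_ = _⊕_ R

  ≈ᴵ-trans : ∀ I J K → I ≈ᴵ J → J ≈ᴵ K → I ≈ᴵ K
  ≈ᴵ-trans _ _ _ (I⊆J , J⊆I) (J⊆K , K⊆J) = (λ x m → J⊆K x (I⊆J x m)) , (λ x m → J⊆I x (K⊆J x m))

  zeroIdeal : Ideal R
  zeroIdeal = record
    { _∈I = λ x → Lift c (x ≈ 0#)
    ; ∈-resp-≈ = λ x≈y (lift x≈0) → lift (trans (sym x≈y) x≈0)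
    ; 0∈ = lift refl
    ; +-closed = λ (lift x≈0) (lift y≈0) → lift (trans (+-cong x≈0 y≈0) (+-identityˡ 0#))
    ; *-closed = λ r (lift x≈0) → lift (trans (*-congˡ x≈0) (zeroʳ r))
    }

  unitIdeal : Ideal R
  unitIdeal = record
    { _∈I = λ _ → ⊤
    ; ∈-resp-≈ = λ _ _ → tt
    ; 0∈ = tt
    ; +-closed = λ _ _ → tt
    ; *-closed = λ _ _ → tt
    }

  ⟨_⟩ : Carrier → Ideal R
  ⟨ a ⟩ = record
    { _∈I = λ x → Σ Carrier λ r → Lift c (x ≈ r * a)
    ; ∈-resp-≈ = λ x≈y (r , lift x≈ra) → r , lift (trans (sym x≈y) x≈ra)
    ; 0∈ = 0# , lift (sym (zeroˡ a))
    ; +-closed = λ (r , lift x≈ra) (s , lift y≈sa) → r + s , lift (trans (+-cong x≈ra y≈sa) (sym (distribʳ a r s)))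
    ; *-closed = λ t (r , lift x≈ra) → t * r , lift (trans (*-congˡ x≈ra) (sym (*-assoc t r a)))
    }

  _∩ᴵ_ : Ideal R → Ideal R → Ideal R
  I ∩ᴵ J = record
    { _∈I = λ x → (I ∈I) x × (J ∈I) x
    ; ∈-resp-≈ = λ x≈y (x∈I , x∈J) → ∈-resp-≈ I x≈y x∈I , ∈-resp-≈ J x≈y x∈J
    ; 0∈ = 0∈ I , 0∈ J
    ; +-closed = λ (x∈I , x∈J) (y∈I , y∈J) → +-closed I x∈I y∈I , +-closed J x∈J y∈J
    ; *-closed = λ r (x∈I , x∈J) → *-closed I r x∈I , *-closed J r x∈J
    }

  a∈⟨a⟩ : ∀ a → (⟨ a ⟩ ∈I) a
  a∈⟨a⟩ a = 1# , lift (sym (*-identityˡ a))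

  zeroIdeal-⊆ : ∀ I → zeroIdeal ⊆ I
  zeroIdeal-⊆ I x (lift x≈0) = ∈-resp-≈ I (sym x≈0) (0∈ I)

  ⊆-unitIdeal : ∀ I → I ⊆ unitIdeal
  ⊆-unitIdeal _ _ _ = tt

  1∈⇒unitIdeal⊆ : ∀ I → (I ∈I) 1# → unitIdeal ⊆ I
  1∈⇒unitIdeal⊆ I 1∈I x _ = ∈-resp-≈ I (*-identityʳ x) (*-closed I x 1∈I)

  1∈⇒≈ᴵunitIdeal : ∀ I → (I ∈I) 1# → I ≈ᴵ unitIdeal
  1∈⇒≈ᴵunitIdeal I 1∈I = ⊆-unitIdeal I , 1∈⇒unitIdeal⊆ I 1∈I

  ⊆-+ᴵˡ : ∀ I J → I ⊆ I +ᴵ J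
  ⊆-+ᴵˡ I J x x∈I = x , 0# , x∈I , 0∈ J , sym (+-identityʳ x)

  ⊆-+ᴵʳ : ∀ I J → J ⊆ I +ᴵ J
  ⊆-+ᴵʳ I J x x∈J = 0# , x , 0∈ I , x∈J , sym (+-identityˡ x)

  +ᴵ-least : ∀ I J K → I ⊆ K → J ⊆ K → I +ᴵ J ⊆ K
  +ᴵ-least I J K I⊆K J⊆K x (a , b , a∈I , b∈J , x≈a+b) =
    ∈-resp-≈ K (sym x≈a+b) (+-closed K (I⊆K a a∈I) (J⊆K b b∈J))

  +ᴵ-mono : ∀ I J I′ J′ → I ⊆ I′ → J ⊆ J′ → I +ᴵ J ⊆ I′ +ᴵ J′
  +ᴵ-mono _ _ _ _ I⊆I′ J⊆J′ x (a , b , a∈I , b∈J , x≈a+b) = a , b , I⊆I′ a a∈I , J⊆J′ b b∈J , x≈a+b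

  +ᴵ-cong : ∀ I J I′ J′ → I ≈ᴵ I′ → J ≈ᴵ J′ → I +ᴵ J ≈ᴵ I′ +ᴵ J′
  +ᴵ-cong I J I′ J′ (I⊆I′ , I′⊆I) (J⊆J′ , J′⊆J) = +ᴵ-mono I J I′ J′ I⊆I′ J⊆J′ , +ᴵ-mono I′ J′ I J I′⊆I J′⊆J

  +ᴵ-comm : ∀ I J → I +ᴵ J ≈ᴵ J +ᴵ I
  +ᴵ-comm I J = flip I J , flip J I
    where
    flip : ∀ I J → I +ᴵ J ⊆ J +ᴵ I
    flip _ _ x (a , b , a∈I , b∈J , x≈a+b) = b , a , b∈J , a∈I , trans x≈a+b (+-comm a b)

  +ᴵ-absorbˡ : ∀ I J → I ⊆ J → I +ᴵ J ≈ᴵ J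
  +ᴵ-absorbˡ I J I⊆J = +ᴵ-least I J J I⊆J (λ _ m → m) , ⊆-+ᴵʳ I J

  +ᴵ-absorbʳ : ∀ I J → J ⊆ I → I +ᴵ J ≈ᴵ I
  +ᴵ-absorbʳ I J J⊆I = +ᴵ-least I J I (λ _ m → m) J⊆I , ⊆-+ᴵˡ I J

  +ᴵ-idem : ∀ I → I +ᴵ I ≈ᴵ I
  +ᴵ-idem I = +ᴵ-absorbˡ I I (λ _ m → m)

  +ᴵ-identityˡ : ∀ I → zeroIdeal +ᴵ I ≈ᴵ I
  +ᴵ-identityˡ I = +ᴵ-absorbˡ zeroIdeal I (zeroIdeal-⊆ I)

  +ᴵ-identityʳ : ∀ I → I +ᴵ zeroIdeal ≈ᴵ I
  +ᴵ-identityʳ I = +ᴵ-absorbʳ I zeroIdeal (zeroIdeal-⊆ I)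

  +ᴵ-zeroˡ : ∀ I → unitIdeal +ᴵ I ≈ᴵ unitIdeal
  +ᴵ-zeroˡ I = +ᴵ-absorbʳ unitIdeal I (⊆-unitIdeal I)

  +ᴵ-zeroʳ : ∀ I → I +ᴵ unitIdeal ≈ᴵ unitIdeal
  +ᴵ-zeroʳ I = +ᴵ-absorbˡ I unitIdeal (⊆-unitIdeal I)

  1∈+ᴵˡ : ∀ I J → (I ∈I) 1# → ((I +ᴵ J) ∈I) 1#
  1∈+ᴵˡ I J = ⊆-+ᴵˡ I J 1#

  1∈+ᴵʳ : ∀ I J → (J ∈I) 1# → ((I +ᴵ J) ∈I) 1#
  1∈+ᴵʳ I J = ⊆-+ᴵʳ I J 1#

  prime-resp-≈ᴵ : ∀ I J → I ≈ᴵ J → IsPrime R I → IsPrime R J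
  prime-resp-≈ᴵ I J (I⊆J , J⊆I) (I-proper , I-prime) =
    (λ 1∈J → I-proper (J⊆I 1# 1∈J)) ,
    λ a b ab∈J → Sum.map (I⊆J a) (I⊆J b) (I-prime a b (J⊆I _ ab∈J))

  proper⇒1≉0 : ∀ I → Proper R I → ¬ (1# ≈ 0#)
  proper⇒1≉0 I I-proper 1≈0 = I-proper (∈-resp-≈ I (sym 1≈0) (0∈ I))

  unitIdeal-nonzero : ¬ (1# ≈ 0#) → NonZeroIdeal R unitIdeal
  unitIdeal-nonzero 1≉0 = 1# , tt , 1≉0

  zeroIdeal-proper : ¬ (1# ≈ 0#) → Proper R zeroIdeal
  zeroIdeal-proper 1≉0 (lift 1≈0) = 1≉0 1≈0

  unitIdeal≉zeroIdeal : ¬ (1# ≈ 0#) → ¬ (unitIdeal ≈ᴵ zeroIdeal)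
  unitIdeal≉zeroIdeal 1≉0 (unit⊆0 , _) = 1≉0 (lower (unit⊆0 1# tt))

  unitIdeal≉proper : ∀ I → Proper R I → ¬ (unitIdeal ≈ᴵ I)
  unitIdeal≉proper I I-proper (unit⊆I , _) = I-proper (unit⊆I 1# tt)

  ≉ᴵ-sym : ∀ I J → ¬ (I ≈ᴵ J) → ¬ (J ≈ᴵ I)
  ≉ᴵ-sym _ _ I≉J J≈I = I≉J (swap J≈I)

  nonzero-mono : ∀ I J → I ⊆ J → NonZeroIdeal R I → NonZeroIdeal R J
  nonzero-mono I J I⊆J (x , x∈I , x≉0) = x , I⊆J x x∈I , x≉0

  nonzero≉zeroIdeal : ∀ I → NonZeroIdeal R I → ¬ (I ≈ᴵ zeroIdeal)
  nonzero≉zeroIdeal I (x , x∈I , x≉0) (I⊆0 , _) = x≉0 (lower (I⊆0 x x∈I))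

  module Classical (em : ExcludedMiddle (c ⊔ ℓ)) where
    open import Relation.Binary.Reasoning.Setoid setoid

    private
      dne : {P : Set (c ⊔ ℓ)} → ¬ ¬ P → P
      dne = em⇒dne em

      dneℓ : {P : Set ℓ} → ¬ ¬ P → P
      dneℓ = em⇒dne (lowerEM c em)

    maximal⇒comaximal : ∀ M I → IsMaximal R M → ¬ (I ⊆ M) → ((M +ᴵ I) ∈I) 1#
    maximal⇒comaximal M I (_ , M-maximal) I⊈M = dne λ 1∉M+I →
      I⊈M λ x x∈I → M-maximal (M +ᴵ I) (⊆-+ᴵˡ M I) 1∉M+I x (⊆-+ᴵʳ M I x x∈I)

    maximal⇒prime : ∀ M → IsMaximal R M → IsPrime R M
    maximal⇒prime M M-max@(M-proper , _) = M-proper , prime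
      where
      prime : ∀ a b → (M ∈I) (a * b) → (M ∈I) a ⊎ (M ∈I) b
      prime a b ab∈M with em {(M ∈I) a}
      ... | yes a∈M = inj₁ a∈M
      ... | no a∉M with maximal⇒comaximal M ⟨ a ⟩ M-max (λ ⟨a⟩⊆M → a∉M (⟨a⟩⊆M a (a∈⟨a⟩ a)))
      ... | m , x , m∈M , (r , lift x≈ra) , 1≈m+x =
        inj₂ (∈-resp-≈ M b≈ (+-closed M (*-closed M b m∈M) (*-closed M r ab∈M)))
        where
        b≈ : b * m + r * (a * b) ≈ b
        b≈ = begin
          b * m + r * (a * b)  ≈⟨ +-congˡ (trans (sym (*-assoc r a b)) (*-comm (r * a) b)) ⟩
          b * m + b * (r * a)  ≈⟨ distribˡ b m (r * a) ⟨
          b * (m + r * a)      ≈⟨ *-congˡ (trans (+-congˡ (sym x≈ra)) (sym 1≈m+x)) ⟩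
          b * 1#               ≈⟨ *-identityʳ b ⟩
          b                    ∎

    maximal-zero⇒field : ∀ M → IsMaximal R M → ¬ NonZeroIdeal R M → IsField R
    maximal-zero⇒field M M-max@(M-proper , _) M-zero = proper⇒1≉0 M M-proper , inverse
      where
      inverse : ∀ x → ¬ (x ≈ 0#) → Σ Carrier λ y → x * y ≈ 1#
      inverse x x≉0 with maximal⇒comaximal M ⟨ x ⟩ M-max (λ ⟨x⟩⊆M → M-zero (x , ⟨x⟩⊆M x (a∈⟨a⟩ x) , x≉0))
      ... | m , y , m∈M , (r , lift y≈rx) , 1≈m+y = r , (begin
        x * r   ≈⟨ *-comm x r ⟩
        r * x   ≈⟨ y≈rx ⟨
        y       ≈⟨ +-identityˡ y ⟨
        0# + y  ≈⟨ +-congʳ m≈0 ⟨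
        m + y   ≈⟨ 1≈m+y ⟨
        1#      ∎)
        where
        m≈0 : m ≈ 0#
        m≈0 = dneℓ λ m≉0 → M-zero (m , m∈M , m≉0)

    zero-or-nonzero : ∀ J → J ⊆ zeroIdeal ⊎ NonZeroIdeal R J
    zero-or-nonzero J with em {NonZeroIdeal R J}
    ... | yes J-nonzero = inj₂ J-nonzero
    ... | no J-zero = inj₁ λ x x∈J → lift (dneℓ λ x≉0 → J-zero (x , x∈J , x≉0))

    field⇒zero-or-unit : IsField R → ∀ J → J ⊆ zeroIdeal ⊎ (J ∈I) 1#
    field⇒zero-or-unit (_ , inverse) J with zero-or-nonzero J
    ... | inj₁ J-zero = inj₁ J-zero
    ... | inj₂ (y , y∈J , y≉0) =
      inj₂ (∈-resp-≈ J (trans (*-comm _ y) (proj₂ (inverse y y≉0))) (*-closed J (proj₁ (inverse y y≉0)) y∈J))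

    field⇒zero-prime : IsField R → IsPrime R zeroIdeal
    field⇒zero-prime (1≉0 , inverse) = zeroIdeal-proper 1≉0 , prime
      where
      prime : ∀ a b → (zeroIdeal ∈I) (a * b) → (zeroIdeal ∈I) a ⊎ (zeroIdeal ∈I) b
      prime a b (lift ab≈0) with em {Lift c (a ≈ 0#)}
      ... | yes a≈0 = inj₁ a≈0
      ... | no a≉0 with inverse a (λ a≈0 → a≉0 (lift a≈0))
      ... | a⁻¹ , aa⁻¹≈1 = inj₂ (lift (begin
        b               ≈⟨ *-identityˡ b ⟨
        1# * b          ≈⟨ *-congʳ (trans (*-comm a⁻¹ a) aa⁻¹≈1) ⟨
        (a⁻¹ * a) * b   ≈⟨ *-assoc a⁻¹ a b ⟩
        a⁻¹ * (a * b)   ≈⟨ *-congˡ ab≈0 ⟩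
        a⁻¹ * 0#        ≈⟨ zeroʳ a⁻¹ ⟩
        0#              ∎))

    -- Avoids Zorn's lemma: if I ⊈ M then I + M = R, and minimality of M makes I itself maximal,
    -- contradicting the uniqueness of M.
    onlyNonzeroProperIdeal : ∀ M → IsMaximal R M → (∀ N → IsMaximal R N → N ≈ᴵ M) → NonZeroIdeal R M →
      (∀ B → B ⊆ M → NonZeroIdeal R B → B ≈ᴵ M) → OnlyNonzeroProperIdeal R M
    onlyNonzeroProperIdeal M M-max M-unique M-nonzero M-minimal = M-nonzero , proj₁ M-max , only
      where
      only : ∀ I → NonZeroIdeal R I → Proper R I → I ≈ᴵ M
      only I I-nonzero I-proper with em {I ⊆ M}
      ... | yes I⊆M = M-minimal I I⊆M I-nonzero
      ... | no I⊈M with maximal⇒comaximal M I M-max I⊈M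
      ... | m , e , m∈M , e∈I , 1≈m+e = ⊥-elim (I⊈M (proj₁ (M-unique I I-max)))
        where
        I-max : IsMaximal R I
        I-max = I-proper , absorbed
          where
          absorbed : ∀ J → I ⊆ J → Proper R J → J ⊆ I
          absorbed J I⊆J J-proper x x∈J with em {NonZeroIdeal R (J ∩ᴵ M)}
          ... | yes J∩M-nonzero =
            ⊥-elim (J-proper (∈-resp-≈ J (sym 1≈m+e) (+-closed J m∈J (I⊆J e e∈I))))
            where
            m∈J : (J ∈I) m
            m∈J = proj₁ (proj₂ (M-minimal (J ∩ᴵ M) (λ _ → proj₂) J∩M-nonzero) m m∈M)
          ... | no J∩M-zero = ∈-resp-≈ I x*e≈x (*-closed I x e∈I)
            where
            x*m≈0 : x * m ≈ 0#
            x*m≈0 = dneℓ λ x*m≉0 → J∩M-zero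
              (x * m , (∈-resp-≈ J (*-comm m x) (*-closed J m x∈J) , *-closed M x m∈M) , x*m≉0)
            x*e≈x : x * e ≈ x
            x*e≈x = begin
              x * e             ≈⟨ +-identityˡ (x * e) ⟨
              0# + x * e        ≈⟨ +-congʳ x*m≈0 ⟨
              x * m + x * e     ≈⟨ distribˡ x m e ⟨
              x * (m + e)       ≈⟨ *-congˡ 1≈m+e ⟨
              x * 1#            ≈⟨ *-identityʳ x ⟩
              x                 ∎

module Preimage {c ℓ : Level} (R T : CommutativeRing c ℓ)
  (f : CommutativeRing.Carrier R → CommutativeRing.Carrier T)
  (f-iso : RingMorphisms.IsRingIsomorphism (CommutativeRing.rawRing R) (CommutativeRing.rawRing T) f) where
  private
    module R = CommutativeRing R
    module T = CommutativeRing T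
    module f = RingMorphisms.IsRingIsomorphism f-iso
    open IdealLattice T

    section : T.Carrier → R.Carrier
    section y = proj₁ (f.surjective y)

    f∘section : ∀ y → f (section y) T.≈ y
    f∘section y = proj₂ (f.surjective y) R.refl

  pre : Ideal T → Ideal R
  pre J = record
    { _∈I = λ x → (J ∈I) (f x)
    ; ∈-resp-≈ = λ x≈y → ∈-resp-≈ J (f.⟦⟧-cong x≈y)
    ; 0∈ = ∈-resp-≈ J (T.sym f.0#-homo) (0∈ J)
    ; +-closed = λ {x} {y} fx∈J fy∈J → ∈-resp-≈ J (T.sym (f.+-homo x y)) (+-closed J fx∈J fy∈J)
    ; *-closed = λ r {x} fx∈J → ∈-resp-≈ J (T.sym (f.*-homo r x)) (*-closed J (f r) fx∈J)
    }

  image : Ideal R → Ideal T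
  image I = record
    { _∈I = λ y → Σ R.Carrier λ x → (I ∈I) x × f x T.≈ y
    ; ∈-resp-≈ = λ y≈y′ (x , x∈I , fx≈y) → x , x∈I , T.trans fx≈y y≈y′
    ; 0∈ = R.0# , 0∈ I , f.0#-homo
    ; +-closed = λ (x , x∈I , fx≈y) (x′ , x′∈I , fx′≈y′) →
        x R.+ x′ , +-closed I x∈I x′∈I , T.trans (f.+-homo x x′) (T.+-cong fx≈y fx′≈y′)
    ; *-closed = λ s (x , x∈I , fx≈y) →
        section s R.* x , *-closed I _ x∈I , T.trans (f.*-homo _ x) (T.*-cong (f∘section s) fx≈y)
    }

  pre-mono : ∀ J K → J ⊆ K → _⊆I_ R (pre J) (pre K)
  pre-mono J K J⊆K x = J⊆K (f x)

  pre-cong : ∀ J K → J ≈ᴵ K → _≐_ R (pre J) (pre K)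
  pre-cong J K (J⊆K , K⊆J) = pre-mono J K J⊆K , pre-mono K J K⊆J

  pre-reflects-⊆ : ∀ J K → _⊆I_ R (pre J) (pre K) → J ⊆ K
  pre-reflects-⊆ J K preJ⊆preK y y∈J =
    ∈-resp-≈ K (f∘section y) (preJ⊆preK (section y) (∈-resp-≈ J (T.sym (f∘section y)) y∈J))

  pre-+ᴵ : ∀ J K → _≐_ R (_⊕_ R (pre J) (pre K)) (pre (J +ᴵ K))
  pre-+ᴵ J K = to , from
    where
    to : _⊆I_ R (_⊕_ R (pre J) (pre K)) (pre (J +ᴵ K))
    to x (a , b , fa∈J , fb∈K , x≈a+b) = f a , f b , fa∈J , fb∈K , T.trans (f.⟦⟧-cong x≈a+b) (f.+-homo a b)
    from : _⊆I_ R (pre (J +ᴵ K)) (_⊕_ R (pre J) (pre K))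
    from x (a , b , a∈J , b∈K , fx≈a+b) =
      section a , section b ,
      ∈-resp-≈ J (T.sym (f∘section a)) a∈J , ∈-resp-≈ K (T.sym (f∘section b)) b∈K ,
      f.injective (T.trans fx≈a+b
        (T.trans (T.+-cong (T.sym (f∘section a)) (T.sym (f∘section b))) (T.sym (f.+-homo _ _))))

  pre-1∈ : ∀ J → (J ∈I) T.1# → (pre J ∈I) R.1#
  pre-1∈ J = ∈-resp-≈ J (T.sym f.1#-homo)

  pre-proper : ∀ J → Proper T J → Proper R (pre J)
  pre-proper J J-proper 1∈preJ = J-proper (∈-resp-≈ J f.1#-homo 1∈preJ)

  pre-prime : ∀ J → IsPrime T J → IsPrime R (pre J)
  pre-prime J (J-proper , J-prime) =
    pre-proper J J-proper , λ a b fab∈J → J-prime (f a) (f b) (∈-resp-≈ J (f.*-homo a b) fab∈J)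

  pre-nonzero : ∀ J → NonZeroIdeal T J → NonZeroIdeal R (pre J)
  pre-nonzero J (y , y∈J , y≉0) =
    section y , ∈-resp-≈ J (T.sym (f∘section y)) y∈J ,
    λ x≈0 → y≉0 (T.trans (T.sym (f∘section y)) (T.trans (f.⟦⟧-cong x≈0) f.0#-homo))

  pre-nonzero⁻¹ : ∀ J → NonZeroIdeal R (pre J) → NonZeroIdeal T J
  pre-nonzero⁻¹ J (x , fx∈J , x≉0) = f x , fx∈J , λ fx≈0 → x≉0 (f.injective (T.trans fx≈0 (T.sym f.0#-homo)))

  ≈ᴵ-pre-image : ∀ I → _≐_ R I (pre (image I))
  ≈ᴵ-pre-image I = (λ x x∈I → x , x∈I , T.refl) , λ x (x′ , x′∈I , fx′≈fx) → ∈-resp-≈ I (f.injective fx′≈fx) x′∈I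

module ProductIdeals {c ℓ : Level} {n : ℕ} (Rs : Fin n → CommutativeRing c ℓ) where
  private
    module Rᵢ (i : Fin n) = CommutativeRing (Rs i)
    module Π = CommutativeRing (Πᴿ Rs)
    module Lᵢ (i : Fin n) = IdealLattice (Rs i)

  Ideals : Set (Level.suc (c ⊔ ℓ))
  Ideals = (i : Fin n) → Ideal (Rs i)

  single : (i : Fin n) → Rᵢ.Carrier i → Π.Carrier
  single i a j with i Fin.≟ j
  ... | yes ≡.refl = a
  ... | no _ = Rᵢ.0# j

  single-≈ : ∀ i a → Rᵢ._≈_ i (single i a i) a
  single-≈ i a with i Fin.≟ i
  ... | yes ≡.refl = Rᵢ.refl i
  ... | no i≢i = ⊥-elim (i≢i ≡.refl)

  single-≉ : ∀ i a j → i ≢ j → Rᵢ._≈_ j (single i a j) (Rᵢ.0# j)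
  single-≉ i a j i≢j with i Fin.≟ j
  ... | yes ≡.refl = ⊥-elim (i≢j ≡.refl)
  ... | no _ = Rᵢ.refl j

  Πᴵ : Ideals → Ideal (Πᴿ Rs)
  Πᴵ J = record
    { _∈I = λ x → ∀ i → (J i ∈I) (x i)
    ; ∈-resp-≈ = λ x≈y x∈J i → ∈-resp-≈ (J i) (x≈y i) (x∈J i)
    ; 0∈ = λ i → 0∈ (J i)
    ; +-closed = λ x∈J y∈J i → +-closed (J i) (x∈J i) (y∈J i)
    ; *-closed = λ r x∈J i → *-closed (J i) (r i) (x∈J i)
    }

  single∈Πᴵ : ∀ J i {a} → (J i ∈I) a → (Πᴵ J ∈I) (single i a)
  single∈Πᴵ J i {a} a∈Ji j with i Fin.≟ j
  ... | yes ≡.refl = a∈Ji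
  ... | no _ = 0∈ (J j)

  component : Ideal (Πᴿ Rs) → Ideals
  component I i = record
    { _∈I = λ a → (I ∈I) (single i a)
    ; ∈-resp-≈ = λ a≈b → ∈-resp-≈ I (single-cong a≈b)
    ; 0∈ = ∈-resp-≈ I single-0 (0∈ I)
    ; +-closed = λ {a} {b} → λ a∈ b∈ → ∈-resp-≈ I (single-+ a b) (+-closed I a∈ b∈)
    ; *-closed = λ r {a} a∈ → ∈-resp-≈ I (single-* r a) (*-closed I (single i r) a∈)
    }
    where
    single-cong : ∀ {a b} → Rᵢ._≈_ i a b → single i a Π.≈ single i b
    single-cong a≈b j with i Fin.≟ j
    ... | yes ≡.refl = a≈b
    ... | no _ = Rᵢ.refl j
    single-0 : Π.0# Π.≈ single i (Rᵢ.0# i)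
    single-0 j with i Fin.≟ j
    ... | yes ≡.refl = Rᵢ.refl j
    ... | no _ = Rᵢ.refl j
    single-+ : ∀ a b → single i a Π.+ single i b Π.≈ single i (Rᵢ._+_ i a b)
    single-+ a b j with i Fin.≟ j
    ... | yes ≡.refl = Rᵢ.refl j
    ... | no _ = Rᵢ.+-identityˡ j _
    single-* : ∀ r a → single i r Π.* single i a Π.≈ single i (Rᵢ._*_ i r a)
    single-* r a j with i Fin.≟ j
    ... | yes ≡.refl = Rᵢ.refl j
    ... | no _ = Rᵢ.zeroˡ j _

  ⊆-Πᴵ-component : ∀ I → _⊆I_ (Πᴿ Rs) I (Πᴵ (component I))
  ⊆-Πᴵ-component I x x∈I i = ∈-resp-≈ I projection (*-closed I (single i (Rᵢ.1# i)) x∈I)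
    where
    projection : single i (Rᵢ.1# i) Π.* x Π.≈ single i (x i)
    projection j with i Fin.≟ j
    ... | yes ≡.refl = Rᵢ.*-identityˡ j _
    ... | no _ = Rᵢ.zeroˡ j _

  Πᴵ-mono : ∀ J K → (∀ i → Lᵢ._⊆_ i (J i) (K i)) → _⊆I_ (Πᴿ Rs) (Πᴵ J) (Πᴵ K)
  Πᴵ-mono J K J⊆K x x∈J i = J⊆K i (x i) (x∈J i)

  Πᴵ-reflects-⊆ : ∀ J K → _⊆I_ (Πᴿ Rs) (Πᴵ J) (Πᴵ K) → ∀ i → Lᵢ._⊆_ i (J i) (K i)
  Πᴵ-reflects-⊆ J K ΠJ⊆ΠK i a a∈Ji = ∈-resp-≈ (K i) (single-≈ i a) (ΠJ⊆ΠK (single i a) (single∈Πᴵ J i a∈Ji) i)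

  Πᴵ-+ᴵ : ∀ J K → _≐_ (Πᴿ Rs) (_⊕_ (Πᴿ Rs) (Πᴵ J) (Πᴵ K)) (Πᴵ (λ i → Lᵢ._+ᴵ_ i (J i) (K i)))
  Πᴵ-+ᴵ J K = (λ x (a , b , a∈J , b∈K , x≈a+b) i → a i , b i , a∈J i , b∈K i , x≈a+b i) ,
    λ x x∈J+K → (λ i → proj₁ (x∈J+K i)) , (λ i → proj₁ (proj₂ (x∈J+K i))) ,
      (λ i → proj₁ (proj₂ (proj₂ (x∈J+K i)))) , (λ i → proj₁ (proj₂ (proj₂ (proj₂ (x∈J+K i))))) ,
      (λ i → proj₂ (proj₂ (proj₂ (proj₂ (x∈J+K i)))))

  Πᴵ-proper : ∀ J i → Proper (Rs i) (J i) → Proper (Πᴿ Rs) (Πᴵ J)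
  Πᴵ-proper J i Ji-proper 1∈ΠJ = Ji-proper (1∈ΠJ i)

  Πᴵ-nonzero : ∀ J i → NonZeroIdeal (Rs i) (J i) → NonZeroIdeal (Πᴿ Rs) (Πᴵ J)
  Πᴵ-nonzero J i (a , a∈Ji , a≉0) =
    single i a , single∈Πᴵ J i a∈Ji , λ single≈0 → a≉0 (Rᵢ.trans i (Rᵢ.sym i (single-≈ i a)) (single≈0 i))

  -- Π Rs / Π J ≅ R_k / J_k, since every other J_i is the whole of R_i.
  Πᴵ-prime : ∀ J k → IsPrime (Rs k) (J k) → (∀ i → i ≢ k → (J i ∈I) (Rᵢ.1# i)) → IsPrime (Πᴿ Rs) (Πᴵ J)
  Πᴵ-prime J k (Jk-proper , Jk-prime) J-unit = Πᴵ-proper J k Jk-proper , prime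
    where
    at-k : ∀ x → (J k ∈I) (x k) → (Πᴵ J ∈I) x
    at-k x xk∈Jk i with i Fin.≟ k
    ... | yes ≡.refl = xk∈Jk
    ... | no i≢k = Lᵢ.1∈⇒unitIdeal⊆ i (J i) (J-unit i i≢k) (x i) tt
    prime : ∀ a b → (Πᴵ J ∈I) (a Π.* b) → (Πᴵ J ∈I) a ⊎ (Πᴵ J ∈I) b
    prime a b ab∈ΠJ = Sum.map (at-k a) (at-k b) (Jk-prime (a k) (b k) (ab∈ΠJ k))

Πᴵ-component₂ : ∀ {c ℓ} (Rs : Fin 2 → CommutativeRing c ℓ) I →
  _≐_ (Πᴿ Rs) I (ProductIdeals.Πᴵ Rs (ProductIdeals.component Rs I))
Πᴵ-component₂ Rs I = ⊆-Πᴵ-component I , λ x x∈ΠI → ∈-resp-≈ I (sum≈ x) (+-closed I (x∈ΠI zero) (x∈ΠI (suc zero)))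
  where
  open ProductIdeals Rs
  module R₀ = CommutativeRing (Rs zero)
  module R₁ = CommutativeRing (Rs (suc zero))
  sum≈ : ∀ x → CommutativeRing._≈_ (Πᴿ Rs) (CommutativeRing._+_ (Πᴿ Rs) (single zero (x zero)) (single (suc zero) (x (suc zero)))) x
  sum≈ x zero = R₀.trans (R₀.+-cong (single-≈ zero (x zero)) (single-≉ (suc zero) (x (suc zero)) zero λ ())) (R₀.+-identityʳ _)
  sum≈ x (suc zero) = R₁.trans (R₁.+-cong (single-≉ zero (x zero) (suc zero) λ ()) (single-≈ (suc zero) (x (suc zero)))) (R₁.+-identityˡ _)

module PISProperties {c ℓ : Level} (R : CommutativeRing c ℓ) where
  open Graph (PIS R)
  open IdealLattice R

  ≃-refl : ∀ v → v ≃ v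
  ≃-refl _ = (λ _ m → m) , (λ _ m → m)

  ≃-trans : ∀ u v w → u ≃ v → v ≃ w → u ≃ w
  ≃-trans _ _ _ (p , q) (p′ , q′) = (λ x m → p′ x (p x m)) , (λ x m → q x (q′ x m))

  Adj⇒≄ : ∀ v w → Adj v w → ¬ (v ≃ w)
  Adj⇒≄ _ _ = proj₁

  Adj-sym : ∀ v w → Adj v w → Adj w v
  Adj-sym v w (v≄w , prime) =
    (λ w≃v → v≄w (swap w≃v)) ,
    prime-resp-≈ᴵ (proj₁ v +ᴵ proj₁ w) (proj₁ w +ᴵ proj₁ v) (+ᴵ-comm (proj₁ v) (proj₁ w)) prime

  Adj-resp-≃ : ∀ v v′ w w′ → v ≃ v′ → w ≃ w′ → Adj v w → Adj v′ w′
  Adj-resp-≃ v v′ w w′ v≃v′ w≃w′ (v≄w , prime) =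
    (λ v′≃w′ → v≄w (≃-trans v v′ w v≃v′ (≃-trans v′ w′ w v′≃w′ (swap w≃w′)))) ,
    prime-resp-≈ᴵ (proj₁ v +ᴵ proj₁ w) (proj₁ v′ +ᴵ proj₁ w′) (+ᴵ-cong (proj₁ v) (proj₁ w) (proj₁ v′) (proj₁ w′) v≃v′ w≃w′) prime

module _ {v e : Level} (G : Graph v e) where
  open Graph G

  module Diamond (≃-refl : ∀ {x} → x ≃ x) (≃-sym : ∀ {x y} → x ≃ y → y ≃ x)
                 (Adj⇒≄ : ∀ {x y} → Adj x y → ¬ (x ≃ y)) where

    triangle : ∀ {x y z} → Adj x y → Adj y z → Adj z x → Cycle G
    triangle {x} {y} {z} x∼y y∼z z∼x = record { len = 0 ; vtx = corner ; distinct = distinct′ ; adjacent = side }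
      where
      corner : Fin 3 → V
      corner zero = x
      corner (suc zero) = y
      corner (suc (suc zero)) = z
      side : ∀ i → Adj (corner i) (corner (next i))
      side zero = x∼y
      side (suc zero) = y∼z
      side (suc (suc zero)) = z∼x
      distinct′ : ∀ i j → corner i ≃ corner j → i ≡ j
      distinct′ zero zero _ = ≡.refl
      distinct′ (suc zero) (suc zero) _ = ≡.refl
      distinct′ (suc (suc zero)) (suc (suc zero)) _ = ≡.refl
      distinct′ zero (suc zero) x≃y = ⊥-elim (Adj⇒≄ x∼y x≃y)
      distinct′ (suc zero) zero y≃x = ⊥-elim (Adj⇒≄ x∼y (≃-sym y≃x))
      distinct′ (suc zero) (suc (suc zero)) y≃z = ⊥-elim (Adj⇒≄ y∼z y≃z)
      distinct′ (suc (suc zero)) (suc zero) z≃y = ⊥-elim (Adj⇒≄ y∼z (≃-sym z≃y))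
      distinct′ (suc (suc zero)) zero z≃x = ⊥-elim (Adj⇒≄ z∼x z≃x)
      distinct′ zero (suc (suc zero)) x≃z = ⊥-elim (Adj⇒≄ z∼x (≃-sym x≃z))

    -- The triangles abc and abd are different cycles (the edge ca lies only on the first)
    -- sharing the two vertices a and b.
    diamond⇒¬cactus : ∀ a b c d → Adj a b → Adj b c → Adj c a → Adj b d → Adj d a → ¬ (c ≃ d) → ¬ IsCactus G
    diamond⇒¬cactus a b c d a∼b b∼c c∼a b∼d d∼a c≄d (_ , at-most-one-common) =
      Adj⇒≄ a∼b (at-most-one-common abc abd abc≠abd a b
        (zero , ≃-refl) (zero , ≃-refl) (suc zero , ≃-refl) (suc zero , ≃-refl))
      where
      abc abd : Cycle G
      abc = triangle a∼b b∼c c∼a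
      abd = triangle a∼b b∼d d∼a
      c∉abd : ∀ j → ¬ (c ≃ vtx abd j)
      c∉abd zero c≃a = Adj⇒≄ c∼a c≃a
      c∉abd (suc zero) c≃b = Adj⇒≄ b∼c (≃-sym c≃b)
      c∉abd (suc (suc zero)) c≃d = c≄d c≃d
      abc≠abd : ¬ SameCycle G abc abd
      abc≠abd same with proj₁ (same c a) (suc (suc zero) , inj₁ (≃-refl , ≃-refl))
      ... | j , inj₁ (c≃j , _) = c∉abd j c≃j
      ... | j , inj₂ (_ , c≃j+1) = c∉abd (next j) c≃j+1

next-≢ : ∀ (i : Fin 3) → i ≢ next i
next-≢ zero ()
next-≢ (suc zero) ()
next-≢ (suc (suc zero)) ()

triangle-sides : ∀ (i j : Fin 3) → i ≢ j → next i ≡ j ⊎ next j ≡ i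
triangle-sides zero zero i≢i = ⊥-elim (i≢i ≡.refl)
triangle-sides (suc zero) (suc zero) i≢i = ⊥-elim (i≢i ≡.refl)
triangle-sides (suc (suc zero)) (suc (suc zero)) i≢i = ⊥-elim (i≢i ≡.refl)
triangle-sides zero (suc zero) _ = inj₁ ≡.refl
triangle-sides (suc zero) (suc (suc zero)) _ = inj₁ ≡.refl
triangle-sides (suc (suc zero)) zero _ = inj₁ ≡.refl
triangle-sides (suc zero) zero _ = inj₂ ≡.refl
triangle-sides (suc (suc zero)) (suc zero) _ = inj₂ ≡.refl
triangle-sides zero (suc (suc zero)) _ = inj₂ ≡.refl

PIS-diamond⇒¬cactus : ∀ {c ℓ} (R : CommutativeRing c ℓ) → let open Graph (PIS R) in
  ∀ a b c d → Adj a b → Adj b c → Adj c a → Adj b d → Adj d a → ¬ (c ≃ d) → ¬ IsCactus (PIS R)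
PIS-diamond⇒¬cactus R = Diamond.diamond⇒¬cactus (PIS R) (λ {v} → ≃-refl v) swap (λ {v} {w} → Adj⇒≄ v w)
  where open PISProperties R

module Coordinates {c ℓ : Level} (R : CommutativeRing c ℓ) {n : ℕ} (Rs : Fin n → CommutativeRing c ℓ)
  (f : CommutativeRing.Carrier R → CommutativeRing.Carrier (Πᴿ Rs))
  (f-iso : RingMorphisms.IsRingIsomorphism (CommutativeRing.rawRing R) (CommutativeRing.rawRing (Πᴿ Rs)) f) where
  open ProductIdeals Rs public
  open Preimage R (Πᴿ Rs) f f-iso
  open Graph (PIS R) using (V; _≃_; Adj)
  private
    module ℛ = IdealLattice R
    module Lᵢ (i : Fin n) = IdealLattice (Rs i)
    module Rᵢ (i : Fin n) = CommutativeRing (Rs i)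

  ⟦_⟧ : Ideals → Ideal R
  ⟦ J ⟧ = pre (Πᴵ J)

  _+ᶜ_ : Ideals → Ideals → Ideals
  (J +ᶜ K) i = Lᵢ._+ᴵ_ i (J i) (K i)

  vertex : ∀ J → Σ (Fin n) (λ i → NonZeroIdeal (Rs i) (J i)) → Σ (Fin n) (λ i → Proper (Rs i) (J i)) → V
  vertex J (i , Ji-nonzero) (j , Jj-proper) =
    ⟦ J ⟧ , pre-nonzero (Πᴵ J) (Πᴵ-nonzero J i Ji-nonzero) , pre-proper (Πᴵ J) (Πᴵ-proper J j Jj-proper)

  ⟦⟧-injective : ∀ J K → ⟦ J ⟧ ℛ.≈ᴵ ⟦ K ⟧ → ∀ i → Lᵢ._≈ᴵ_ i (J i) (K i)
  ⟦⟧-injective J K (⟦J⟧⊆⟦K⟧ , ⟦K⟧⊆⟦J⟧) i =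
    Πᴵ-reflects-⊆ J K (pre-reflects-⊆ (Πᴵ J) (Πᴵ K) ⟦J⟧⊆⟦K⟧) i ,
    Πᴵ-reflects-⊆ K J (pre-reflects-⊆ (Πᴵ K) (Πᴵ J) ⟦K⟧⊆⟦J⟧) i

  ⟦⟧-cong : ∀ J K → (∀ i → Lᵢ._≈ᴵ_ i (J i) (K i)) → ⟦ J ⟧ ℛ.≈ᴵ ⟦ K ⟧
  ⟦⟧-cong J K J≈K = pre-cong (Πᴵ J) (Πᴵ K)
    (Πᴵ-mono J K (λ i → proj₁ (J≈K i)) , Πᴵ-mono K J (λ i → proj₂ (J≈K i)))

  ⟦⟧-+ᴵ : ∀ J K → ⟦ J ⟧ ℛ.+ᴵ ⟦ K ⟧ ℛ.≈ᴵ ⟦ J +ᶜ K ⟧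
  ⟦⟧-+ᴵ J K = ℛ.≈ᴵ-trans (⟦ J ⟧ ℛ.+ᴵ ⟦ K ⟧) (pre (_⊕_ (Πᴿ Rs) (Πᴵ J) (Πᴵ K))) ⟦ J +ᶜ K ⟧
    (pre-+ᴵ (Πᴵ J) (Πᴵ K)) (pre-cong (_⊕_ (Πᴿ Rs) (Πᴵ J) (Πᴵ K)) (Πᴵ (J +ᶜ K)) (Πᴵ-+ᴵ J K))

  ⟦⟧-1∈ : ∀ J → (∀ i → (J i ∈I) (Rᵢ.1# i)) → (⟦ J ⟧ ∈I) (CommutativeRing.1# R)
  ⟦⟧-1∈ J = pre-1∈ (Πᴵ J)

  ⟦⟧-comaximal : ∀ J K → (∀ i → ((J +ᶜ K) i ∈I) (Rᵢ.1# i)) → ((⟦ J ⟧ ℛ.+ᴵ ⟦ K ⟧) ∈I) (CommutativeRing.1# R)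
  ⟦⟧-comaximal J K J+K-unit = proj₂ (⟦⟧-+ᴵ J K) _ (⟦⟧-1∈ (J +ᶜ K) J+K-unit)

  ⟦⟧-prime : ∀ L k → IsPrime (Rs k) (L k) → (∀ i → i ≢ k → (L i ∈I) (Rᵢ.1# i)) → IsPrime R ⟦ L ⟧
  ⟦⟧-prime L k Lk-prime L-unit = pre-prime (Πᴵ L) (Πᴵ-prime L k Lk-prime L-unit)

  -- The conclusion is adjacency in PIS R of any two vertices with underlying ideals ⟦ J ⟧ and ⟦ K ⟧.
  ⟦⟧-adjacent : ∀ J K L → (∀ i → Lᵢ._≈ᴵ_ i ((J +ᶜ K) i) (L i)) → IsPrime R ⟦ L ⟧ →
    Σ (Fin n) (λ i → ¬ Lᵢ._≈ᴵ_ i (J i) (K i)) →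
    ¬ (⟦ J ⟧ ℛ.≈ᴵ ⟦ K ⟧) × IsPrime R (⟦ J ⟧ ℛ.+ᴵ ⟦ K ⟧)
  ⟦⟧-adjacent J K L J+K≈L L-prime (i , Ji≉Ki) =
    (λ ⟦J⟧≈⟦K⟧ → Ji≉Ki (⟦⟧-injective J K ⟦J⟧≈⟦K⟧ i)) ,
    ℛ.prime-resp-≈ᴵ ⟦ L ⟧ (⟦ J ⟧ ℛ.+ᴵ ⟦ K ⟧)
      (swap (ℛ.≈ᴵ-trans (⟦ J ⟧ ℛ.+ᴵ ⟦ K ⟧) ⟦ J +ᶜ K ⟧ ⟦ L ⟧ (⟦⟧-+ᴵ J K) (⟦⟧-cong (J +ᶜ K) L J+K≈L)))
      L-prime

  comaximal⇒¬Adj : ∀ v w J K → ⟦ J ⟧ ℛ.⊆ proj₁ v → ⟦ K ⟧ ℛ.⊆ proj₁ w →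
    (∀ i → ((J +ᶜ K) i ∈I) (Rᵢ.1# i)) → ¬ Adj v w
  comaximal⇒¬Adj v w J K ⟦J⟧⊆v ⟦K⟧⊆w J+K-unit (_ , v+w-proper , _) =
    v+w-proper (ℛ.+ᴵ-mono ⟦ J ⟧ ⟦ K ⟧ (proj₁ v) (proj₁ w) ⟦J⟧⊆v ⟦K⟧⊆w _ (⟦⟧-comaximal J K J+K-unit))

  ⟦⟧-zero : ∀ J → (∀ i → Lᵢ._⊆_ i (J i) (Lᵢ.zeroIdeal i)) → ¬ NonZeroIdeal R ⟦ J ⟧
  ⟦⟧-zero J J-zero ⟦J⟧-nonzero with pre-nonzero⁻¹ (Πᴵ J) ⟦J⟧-nonzero
  ... | y , y∈ΠJ , y≉0 = y≉0 λ i → lower (J-zero i (y i) (y∈ΠJ i))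

  coordinates : Ideal R → Ideals
  coordinates I = component (image I)

module LocalFactors {c ℓ : Level} (em : ExcludedMiddle (c ⊔ ℓ)) {n : ℕ}
  (Rs : Fin n → CommutativeRing c ℓ) (Rs-local : ∀ i → IsLocal (Rs i)) where
  private
    module Lᵢ (i : Fin n) = IdealLattice (Rs i)
    module Cᵢ (i : Fin n) = IdealLattice.Classical (Rs i) em

  M : ∀ i → Ideal (Rs i)
  M i = proj₁ (Rs-local i)

  M-maximal : ∀ i → IsMaximal (Rs i) (M i)
  M-maximal i = proj₁ (proj₂ (Rs-local i))

  M-proper : ∀ i → Proper (Rs i) (M i)
  M-proper i = proj₁ (M-maximal i)

  M-prime : ∀ i → IsPrime (Rs i) (M i)
  M-prime i = Cᵢ.maximal⇒prime i (M i) (M-maximal i)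

  1≉0 : ∀ i → ¬ CommutativeRing._≈_ (Rs i) (CommutativeRing.1# (Rs i)) (CommutativeRing.0# (Rs i))
  1≉0 i = Lᵢ.proper⇒1≉0 i (M i) (M-proper i)

  unitIdeal-nonzero : ∀ i → NonZeroIdeal (Rs i) (Lᵢ.unitIdeal i)
  unitIdeal-nonzero i = Lᵢ.unitIdeal-nonzero i (1≉0 i)

  zeroIdeal-proper : ∀ i → Proper (Rs i) (Lᵢ.zeroIdeal i)
  zeroIdeal-proper i = Lᵢ.zeroIdeal-proper i (1≉0 i)

  unitIdeal≉M : ∀ i → ¬ Lᵢ._≈ᴵ_ i (Lᵢ.unitIdeal i) (M i)
  unitIdeal≉M i = Lᵢ.unitIdeal≉proper i (M i) (M-proper i)

module ThreeOrMoreFactors {c ℓ : Level} (em : ExcludedMiddle (c ⊔ ℓ)) (R : CommutativeRing c ℓ) (m : ℕ)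
  (Rs : Fin (3 ℕ.+ m) → CommutativeRing c ℓ) (Rs-local : ∀ i → IsLocal (Rs i))
  (f : CommutativeRing.Carrier R → CommutativeRing.Carrier (Πᴿ Rs))
  (f-iso : RingMorphisms.IsRingIsomorphism (CommutativeRing.rawRing R) (CommutativeRing.rawRing (Πᴿ Rs)) f) where
  open Coordinates R Rs f f-iso
  open LocalFactors em Rs Rs-local
  open Graph (PIS R) using (V)
  private
    module Lᵢ (i : Fin (3 ℕ.+ m)) = IdealLattice (Rs i)

  choose : Bool → ∀ i → Ideal (Rs i)
  choose true = Lᵢ.unitIdeal
  choose false = M

  choose-+ᴵ : ∀ a b i → Lᵢ._≈ᴵ_ i (Lᵢ._+ᴵ_ i (choose a i) (choose b i)) (choose (a ∨ b) i)
  choose-+ᴵ true b i = Lᵢ.+ᴵ-absorbʳ i (Lᵢ.unitIdeal i) (choose b i) (Lᵢ.⊆-unitIdeal i (choose b i))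
  choose-+ᴵ false true i = Lᵢ.+ᴵ-absorbˡ i (M i) (Lᵢ.unitIdeal i) (Lᵢ.⊆-unitIdeal i (M i))
  choose-+ᴵ false false i = Lᵢ.+ᴵ-absorbˡ i (M i) (M i) (λ _ m → m)

  shape : Bool → Bool → Bool → Ideals
  shape a b c zero = choose a zero
  shape a b c (suc zero) = choose b (suc zero)
  shape a b c (suc (suc zero)) = choose c (suc (suc zero))
  shape a b c i@(suc (suc (suc _))) = Lᵢ.unitIdeal i

  shape-+ᶜ : ∀ a b c a′ b′ c′ i →
    Lᵢ._≈ᴵ_ i ((shape a b c +ᶜ shape a′ b′ c′) i) (shape (a ∨ a′) (b ∨ b′) (c ∨ c′) i)
  shape-+ᶜ a b c a′ b′ c′ zero = choose-+ᴵ a a′ zero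
  shape-+ᶜ a b c a′ b′ c′ (suc zero) = choose-+ᴵ b b′ (suc zero)
  shape-+ᶜ a b c a′ b′ c′ (suc (suc zero)) = choose-+ᴵ c c′ (suc (suc zero))
  shape-+ᶜ a b c a′ b′ c′ i@(suc (suc (suc _))) = choose-+ᴵ true true i

  shape-prime₀ : IsPrime R ⟦ shape false true true ⟧
  shape-prime₀ = ⟦⟧-prime (shape false true true) zero (M-prime zero) λ
    { zero 0≢0 → ⊥-elim (0≢0 ≡.refl) ; (suc zero) _ → tt ; (suc (suc zero)) _ → tt ; (suc (suc (suc _))) _ → tt }

  shape-prime₁ : IsPrime R ⟦ shape true false true ⟧
  shape-prime₁ = ⟦⟧-prime (shape true false true) (suc zero) (M-prime (suc zero)) λ
    { zero _ → tt ; (suc zero) 1≢1 → ⊥-elim (1≢1 ≡.refl) ; (suc (suc zero)) _ → tt ; (suc (suc (suc _))) _ → tt }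

  shape-prime₂ : IsPrime R ⟦ shape true true false ⟧
  shape-prime₂ = ⟦⟧-prime (shape true true false) (suc (suc zero)) (M-prime (suc (suc zero))) λ
    { zero _ → tt ; (suc zero) _ → tt ; (suc (suc zero)) 2≢2 → ⊥-elim (2≢2 ≡.refl) ; (suc (suc (suc _))) _ → tt }

  -- Writing ● for the unit ideal and ○ for M in the first three coordinates: ●○○, ○●○, ●●○
  -- pairwise sum to the prime ●●○, while ○○● sums with ○●○ and ●○○ to the primes ○●● and ●○●.
  ¬cactus : ¬ IsCactus (PIS R)
  ¬cactus = PIS-diamond⇒¬cactus R A B C D
    (⟦⟧-adjacent (shape ● ○ ○) (shape ○ ● ○) (shape ● ● ○) (shape-+ᶜ ● ○ ○ ○ ● ○) shape-prime₂ (zero , unitIdeal≉M zero))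
    (⟦⟧-adjacent (shape ○ ● ○) (shape ● ● ○) (shape ● ● ○) (shape-+ᶜ ○ ● ○ ● ● ○) shape-prime₂ (zero , M≉unitIdeal zero))
    (⟦⟧-adjacent (shape ● ● ○) (shape ● ○ ○) (shape ● ● ○) (shape-+ᶜ ● ● ○ ● ○ ○) shape-prime₂ (suc zero , unitIdeal≉M (suc zero)))
    (⟦⟧-adjacent (shape ○ ● ○) (shape ○ ○ ●) (shape ○ ● ●) (shape-+ᶜ ○ ● ○ ○ ○ ●) shape-prime₀ (suc zero , unitIdeal≉M (suc zero)))
    (⟦⟧-adjacent (shape ○ ○ ●) (shape ● ○ ○) (shape ● ○ ●) (shape-+ᶜ ○ ○ ● ● ○ ○) shape-prime₁ (zero , M≉unitIdeal zero))
    (λ C≃D → unitIdeal≉M zero (⟦⟧-injective (shape ● ● ○) (shape ○ ○ ●) C≃D zero))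
    where
    ● ○ : Bool
    ● = true
    ○ = false
    M≉unitIdeal : ∀ i → ¬ Lᵢ._≈ᴵ_ i (M i) (Lᵢ.unitIdeal i)
    M≉unitIdeal i M≈unit = unitIdeal≉M i (swap M≈unit)
    A B C D : V
    A = vertex (shape ● ○ ○) (zero , unitIdeal-nonzero zero) (suc zero , M-proper (suc zero))
    B = vertex (shape ○ ● ○) (suc zero , unitIdeal-nonzero (suc zero)) (zero , M-proper zero)
    C = vertex (shape ● ● ○) (zero , unitIdeal-nonzero zero) (suc (suc zero) , M-proper (suc (suc zero)))
    D = vertex (shape ○ ○ ●) (suc (suc zero) , unitIdeal-nonzero (suc (suc zero))) (zero , M-proper zero)

module BinaryCoordinates {c ℓ : Level} (R : CommutativeRing c ℓ) (Rs : Fin 2 → CommutativeRing c ℓ)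
  (f : CommutativeRing.Carrier R → CommutativeRing.Carrier (Πᴿ Rs))
  (f-iso : RingMorphisms.IsRingIsomorphism (CommutativeRing.rawRing R) (CommutativeRing.rawRing (Πᴿ Rs)) f) where
  open Coordinates R Rs f f-iso public
  open Preimage R (Πᴿ Rs) f f-iso
  private
    module ℛ = IdealLattice R
    module L₀ = IdealLattice (Rs zero)
    module L₁ = IdealLattice (Rs (suc zero))

  infix 5 _⊗_
  _⊗_ : Ideal (Rs zero) → Ideal (Rs (suc zero)) → Ideals
  (X ⊗ Y) zero = X
  (X ⊗ Y) (suc zero) = Y

  ⊗-+ᶜ : ∀ {X Y X′ Y′ X″ Y″} → X L₀.+ᴵ X′ L₀.≈ᴵ X″ → Y L₁.+ᴵ Y′ L₁.≈ᴵ Y″ →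
    ∀ i → IdealLattice._≈ᴵ_ (Rs i) (((X ⊗ Y) +ᶜ (X′ ⊗ Y′)) i) ((X″ ⊗ Y″) i)
  ⊗-+ᶜ X+X′≈X″ _ zero = X+X′≈X″
  ⊗-+ᶜ _ Y+Y′≈Y″ (suc zero) = Y+Y′≈Y″

  ⊗-prime₀ : ∀ P → IsPrime (Rs zero) P → IsPrime R ⟦ P ⊗ L₁.unitIdeal ⟧
  ⊗-prime₀ P P-prime = ⟦⟧-prime (P ⊗ L₁.unitIdeal) zero P-prime λ { zero 0≢0 → ⊥-elim (0≢0 ≡.refl) ; (suc zero) _ → tt }

  ⊗-prime₁ : ∀ P → IsPrime (Rs (suc zero)) P → IsPrime R ⟦ L₀.unitIdeal ⊗ P ⟧
  ⊗-prime₁ P P-prime = ⟦⟧-prime (L₀.unitIdeal ⊗ P) (suc zero) P-prime λ { zero _ → tt ; (suc zero) 1≢1 → ⊥-elim (1≢1 ≡.refl) }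

  ≈ᴵ-⟦coordinates⟧ : ∀ I → I ℛ.≈ᴵ ⟦ coordinates I ⟧
  ≈ᴵ-⟦coordinates⟧ I = ℛ.≈ᴵ-trans I (pre (image I)) ⟦ coordinates I ⟧
    (≈ᴵ-pre-image I) (pre-cong (image I) (Πᴵ (coordinates I)) (Πᴵ-component₂ Rs (image I)))

swap₂ : Fin 2 → Fin 2
swap₂ zero = suc zero
swap₂ (suc zero) = zero

module RingIsomorphisms {c ℓ : Level} where
  private
    CR : Set (Level.suc (c ⊔ ℓ))
    CR = CommutativeRing c ℓ
    Carrier : CR → Set c
    Carrier = CommutativeRing.Carrier

  IsIso : (A B : CR) → (Carrier A → Carrier B) → Set (c ⊔ ℓ)
  IsIso A B = RingMorphisms.IsRingIsomorphism (CommutativeRing.rawRing A) (CommutativeRing.rawRing B)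

  module _ (A B : CR) (h : Carrier A → Carrier B) where
    private
      module A = CommutativeRing A
      module B = CommutativeRing B

    isRingIsomorphism :
      (∀ {x y} → x A.≈ y → h x B.≈ h y) →
      (∀ x y → h (x A.+ y) B.≈ h x B.+ h y) → (∀ x y → h (x A.* y) B.≈ h x B.* h y) →
      h A.0# B.≈ B.0# → h A.1# B.≈ B.1# → (∀ x → h (A.- x) B.≈ B.- (h x)) →
      (∀ {x y} → h x B.≈ h y → x A.≈ y) →
      (∀ y → Σ (Carrier A) λ x → ∀ {z} → z A.≈ x → h z B.≈ y) → IsIso A B h
    isRingIsomorphism cong +-homo *-homo 0-homo 1-homo neg-homo injective surjective = record
      { isRingMonomorphism = record
        { isRingHomomorphism = record
          { isSemiringHomomorphism = record
            { isNearSemiringHomomorphism = record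
              { +-isMonoidHomomorphism = record
                { isMagmaHomomorphism = record { isRelHomomorphism = record { cong = cong } ; homo = +-homo }
                ; ε-homo = 0-homo }
              ; *-homo = *-homo }
            ; 1#-homo = 1-homo }
          ; -‿homo = neg-homo }
        ; injective = injective }
      ; surjective = surjective }

  ≅ᴿ-trans : (A B C : CR) → A ≅ᴿ B → B ≅ᴿ C → A ≅ᴿ C
  ≅ᴿ-trans _ _ C (g , g-iso) (h , h-iso) = (λ x → h (g x)) , Composition.isRingIsomorphism (CommutativeRing.trans C) g-iso h-iso

  module _ (Rs : Fin 2 → CR) where
    private
      module R₀ = CommutativeRing (Rs zero)
      module R₁ = CommutativeRing (Rs (suc zero))

    Π₂≅× : Πᴿ Rs ≅ᴿ (Rs zero ×ᴿ Rs (suc zero))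
    Π₂≅× = (λ x → x zero , x (suc zero)) , isRingIsomorphism (Πᴿ Rs) (Rs zero ×ᴿ Rs (suc zero)) _
      (λ x≈y → x≈y zero , x≈y (suc zero)) (λ _ _ → R₀.refl , R₁.refl) (λ _ _ → R₀.refl , R₁.refl)
      (R₀.refl , R₁.refl) (R₀.refl , R₁.refl) (λ _ → R₀.refl , R₁.refl)
      (λ { (x₀≈y₀ , _) zero → x₀≈y₀ ; (_ , x₁≈y₁) (suc zero) → x₁≈y₁ })
      (λ (a , b) → (λ { zero → a ; (suc zero) → b }) , λ z≈ab → z≈ab zero , z≈ab (suc zero))

    Π₂-swap : Πᴿ Rs ≅ᴿ Πᴿ (λ i → Rs (swap₂ i))
    Π₂-swap = (λ x i → x (swap₂ i)) , isRingIsomorphism (Πᴿ Rs) (Πᴿ (λ i → Rs (swap₂ i))) _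
      (λ x≈y i → x≈y (swap₂ i)) (λ _ _ i → Rˢ.refl i) (λ _ _ i → Rˢ.refl i) (λ i → Rˢ.refl i) (λ i → Rˢ.refl i) (λ _ i → Rˢ.refl i)
      (λ { x≈y zero → x≈y (suc zero) ; x≈y (suc zero) → x≈y zero })
      (λ y → (λ { zero → y (suc zero) ; (suc zero) → y zero }) ,
             λ { z≈ zero → z≈ (suc zero) ; z≈ (suc zero) → z≈ zero })
      where
      module Rˢ (i : Fin 2) = CommutativeRing (Rs (swap₂ i))

  pair : CR → CR → Fin 2 → CR
  pair A B zero = A
  pair A B (suc zero) = B

  ×≅Π₂ : (A B : CR) → (A ×ᴿ B) ≅ᴿ Πᴿ (pair A B)
  ×≅Π₂ A B = to , isRingIsomorphism (A ×ᴿ B) (Πᴿ (pair A B)) to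
    (λ { (x₀≈y₀ , _) zero → x₀≈y₀ ; (_ , x₁≈y₁) (suc zero) → x₁≈y₁ })
    (λ { _ _ zero → A.refl ; _ _ (suc zero) → B.refl })
    (λ { _ _ zero → A.refl ; _ _ (suc zero) → B.refl })
    (λ { zero → A.refl ; (suc zero) → B.refl })
    (λ { zero → A.refl ; (suc zero) → B.refl })
    (λ { _ zero → A.refl ; _ (suc zero) → B.refl })
    (λ x≈y → x≈y zero , x≈y (suc zero))
    (λ y → (y zero , y (suc zero)) , λ { (z₀≈ , _) zero → z₀≈ ; (_ , z₁≈) (suc zero) → z₁≈ })
    where
    module A = CommutativeRing A
    module B = CommutativeRing B
    to : Carrier (A ×ᴿ B) → Carrier (Πᴿ (pair A B))
    to (a , b) zero = a
    to (a , b) (suc zero) = b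


FieldTimesLocalWithOneIdeal : ∀ {c ℓ} → CommutativeRing c ℓ → Set (Level.suc (c ⊔ ℓ))
FieldTimesLocalWithOneIdeal {c} {ℓ} R = Σ (CommutativeRing c ℓ) λ F → Σ (CommutativeRing c ℓ) λ S →
  IsField F × IsLocal S × (Σ (Ideal S) λ M → IsMaximal S M × OnlyNonzeroProperIdeal S M) × R ≅ᴿ (F ×ᴿ S)

module TwoLocalFactors {c ℓ : Level} (em : ExcludedMiddle (c ⊔ ℓ)) (R : CommutativeRing c ℓ)
  (Rs : Fin 2 → CommutativeRing c ℓ) (Rs-local : ∀ i → IsLocal (Rs i))
  (f : CommutativeRing.Carrier R → CommutativeRing.Carrier (Πᴿ Rs))
  (f-iso : RingMorphisms.IsRingIsomorphism (CommutativeRing.rawRing R) (CommutativeRing.rawRing (Πᴿ Rs)) f) where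
  open BinaryCoordinates R Rs f f-iso
  open LocalFactors em Rs Rs-local
  open RingIsomorphisms
  open Graph (PIS R) using (V; _≃_; Adj)
  private
    module ℛ = IdealLattice R
    module L₀ = IdealLattice (Rs zero)
    module L₁ = IdealLattice (Rs (suc zero))
    module C₀ = IdealLattice.Classical (Rs zero) em
    module C₁ = IdealLattice.Classical (Rs (suc zero)) em
    𝟘₀ 𝟙₀ M₀ : Ideal (Rs zero)
    𝟘₀ = L₀.zeroIdeal
    𝟙₀ = L₀.unitIdeal
    M₀ = M zero
    𝟘₁ 𝟙₁ M₁ : Ideal (Rs (suc zero))
    𝟘₁ = L₁.zeroIdeal
    𝟙₁ = L₁.unitIdeal
    M₁ = M (suc zero)

  ¬cactus-both-nonfield : NonZeroIdeal (Rs zero) M₀ → NonZeroIdeal (Rs (suc zero)) M₁ → ¬ IsCactus (PIS R)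
  ¬cactus-both-nonfield M₀-nonzero M₁-nonzero = PIS-diamond⇒¬cactus R A B C D
    (⟦⟧-adjacent (𝟘₀ ⊗ 𝟙₁) (M₀ ⊗ 𝟙₁) L (⊗-+ᶜ (L₀.+ᴵ-identityˡ M₀) (L₁.+ᴵ-idem 𝟙₁)) L-prime
      (zero , L₀.≉ᴵ-sym M₀ 𝟘₀ (L₀.nonzero≉zeroIdeal M₀ M₀-nonzero)))
    (⟦⟧-adjacent (M₀ ⊗ 𝟙₁) (M₀ ⊗ 𝟘₁) L (⊗-+ᶜ (L₀.+ᴵ-idem M₀) (L₁.+ᴵ-identityʳ 𝟙₁)) L-prime
      (suc zero , L₁.unitIdeal≉zeroIdeal (1≉0 (suc zero))))
    (⟦⟧-adjacent (M₀ ⊗ 𝟘₁) (𝟘₀ ⊗ 𝟙₁) L (⊗-+ᶜ (L₀.+ᴵ-identityʳ M₀) (L₁.+ᴵ-identityˡ 𝟙₁)) L-prime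
      (suc zero , L₁.≉ᴵ-sym 𝟙₁ 𝟘₁ (L₁.unitIdeal≉zeroIdeal (1≉0 (suc zero)))))
    (⟦⟧-adjacent (M₀ ⊗ 𝟙₁) (M₀ ⊗ M₁) L (⊗-+ᶜ (L₀.+ᴵ-idem M₀) (L₁.+ᴵ-zeroˡ M₁)) L-prime
      (suc zero , unitIdeal≉M (suc zero)))
    (⟦⟧-adjacent (M₀ ⊗ M₁) (𝟘₀ ⊗ 𝟙₁) L (⊗-+ᶜ (L₀.+ᴵ-identityʳ M₀) (L₁.+ᴵ-zeroʳ M₁)) L-prime
      (suc zero , L₁.≉ᴵ-sym 𝟙₁ M₁ (unitIdeal≉M (suc zero))))
    (λ C≃D → L₁.nonzero≉zeroIdeal M₁ M₁-nonzero (swap (⟦⟧-injective (M₀ ⊗ 𝟘₁) (M₀ ⊗ M₁) C≃D (suc zero))))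
    where
    L : Ideals
    L = M₀ ⊗ 𝟙₁
    L-prime : IsPrime R ⟦ L ⟧
    L-prime = ⊗-prime₀ M₀ (M-prime zero)
    A B C D : V
    A = vertex (𝟘₀ ⊗ 𝟙₁) (suc zero , unitIdeal-nonzero (suc zero)) (zero , zeroIdeal-proper zero)
    B = vertex (M₀ ⊗ 𝟙₁) (suc zero , unitIdeal-nonzero (suc zero)) (zero , M-proper zero)
    C = vertex (M₀ ⊗ 𝟘₁) (zero , M₀-nonzero) (zero , M-proper zero)
    D = vertex (M₀ ⊗ M₁) (zero , M₀-nonzero) (zero , M-proper zero)

  ¬cactus-proper-subideal : ∀ N → L₁._⊆_ N M₁ → NonZeroIdeal (Rs (suc zero)) N → ¬ (N L₁.≈ᴵ M₁) → ¬ IsCactus (PIS R)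
  ¬cactus-proper-subideal N N⊆M₁ N-nonzero N≉M₁ = PIS-diamond⇒¬cactus R A B C D
    (⟦⟧-adjacent (𝟘₀ ⊗ M₁) (𝟙₀ ⊗ M₁) L (⊗-+ᶜ (L₀.+ᴵ-identityˡ 𝟙₀) (L₁.+ᴵ-idem M₁)) L-prime
      (zero , L₀.≉ᴵ-sym 𝟙₀ 𝟘₀ (L₀.unitIdeal≉zeroIdeal (1≉0 zero))))
    (⟦⟧-adjacent (𝟙₀ ⊗ M₁) (𝟙₀ ⊗ 𝟘₁) L (⊗-+ᶜ (L₀.+ᴵ-idem 𝟙₀) (L₁.+ᴵ-identityʳ M₁)) L-prime
      (suc zero , L₁.nonzero≉zeroIdeal M₁ M₁-nonzero))
    (⟦⟧-adjacent (𝟙₀ ⊗ 𝟘₁) (𝟘₀ ⊗ M₁) L (⊗-+ᶜ (L₀.+ᴵ-identityʳ 𝟙₀) (L₁.+ᴵ-identityˡ M₁)) L-prime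
      (zero , L₀.unitIdeal≉zeroIdeal (1≉0 zero)))
    (⟦⟧-adjacent (𝟙₀ ⊗ M₁) (𝟙₀ ⊗ N) L (⊗-+ᶜ (L₀.+ᴵ-idem 𝟙₀) (L₁.+ᴵ-absorbʳ M₁ N N⊆M₁)) L-prime
      (suc zero , L₁.≉ᴵ-sym N M₁ N≉M₁))
    (⟦⟧-adjacent (𝟙₀ ⊗ N) (𝟘₀ ⊗ M₁) L (⊗-+ᶜ (L₀.+ᴵ-identityʳ 𝟙₀) (L₁.+ᴵ-absorbˡ N M₁ N⊆M₁)) L-prime
      (zero , L₀.unitIdeal≉zeroIdeal (1≉0 zero)))
    (λ C≃D → L₁.nonzero≉zeroIdeal N N-nonzero (swap (⟦⟧-injective (𝟙₀ ⊗ 𝟘₁) (𝟙₀ ⊗ N) C≃D (suc zero))))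
    where
    M₁-nonzero : NonZeroIdeal (Rs (suc zero)) M₁
    M₁-nonzero = let (x , x∈N , x≉0) = N-nonzero in x , N⊆M₁ x x∈N , x≉0
    L : Ideals
    L = 𝟙₀ ⊗ M₁
    L-prime : IsPrime R ⟦ L ⟧
    L-prime = ⊗-prime₁ M₁ (M-prime (suc zero))
    A B C D : V
    A = vertex (𝟘₀ ⊗ M₁) (suc zero , M₁-nonzero) (zero , zeroIdeal-proper zero)
    B = vertex (𝟙₀ ⊗ M₁) (zero , unitIdeal-nonzero zero) (suc zero , M-proper (suc zero))
    C = vertex (𝟙₀ ⊗ 𝟘₁) (zero , unitIdeal-nonzero zero) (suc zero , zeroIdeal-proper (suc zero))
    D = vertex (𝟙₀ ⊗ N) (zero , unitIdeal-nonzero zero) (suc zero , λ 1∈N → M-proper (suc zero) (N⊆M₁ _ 1∈N))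

  ¬cactus-both-fields : ¬ NonZeroIdeal (Rs zero) M₀ → ¬ NonZeroIdeal (Rs (suc zero)) M₁ → ¬ IsCactus (PIS R)
  ¬cactus-both-fields M₀-zero M₁-zero (connected , _) = no-walk (connected X Y)
    where
    X Y : V
    X = vertex (𝟙₀ ⊗ 𝟘₁) (zero , unitIdeal-nonzero zero) (suc zero , zeroIdeal-proper (suc zero))
    Y = vertex (𝟘₀ ⊗ 𝟙₁) (suc zero , unitIdeal-nonzero (suc zero)) (zero , zeroIdeal-proper zero)

    -- A vertex of F₀ × F₁ is F₀ × 0, 0 × F₁ or F₀ × F₁, and the last two are comaximal with F₀ × 0.
    X-isolated : ∀ W → ¬ Adj X W
    X-isolated W@(I , I-nonzero , _) X∼W@(X≄W , _)
      with C₀.field⇒zero-or-unit (C₀.maximal-zero⇒field M₀ (M-maximal zero) M₀-zero) (coordinates I zero)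
         | C₁.field⇒zero-or-unit (C₁.maximal-zero⇒field M₁ (M-maximal (suc zero)) M₁-zero) (coordinates I (suc zero))
    ... | _ | inj₂ 1∈C₁ =
      comaximal⇒¬Adj X W (𝟙₀ ⊗ 𝟘₁) (coordinates I) (λ _ m → m) (proj₂ (≈ᴵ-⟦coordinates⟧ I))
        (λ { zero → L₀.1∈+ᴵˡ 𝟙₀ (coordinates I zero) tt ; (suc zero) → L₁.1∈+ᴵʳ 𝟘₁ (coordinates I (suc zero)) 1∈C₁ }) X∼W
    ... | inj₁ C₀-zero | inj₁ C₁-zero =
      ⟦⟧-zero (coordinates I) (λ { zero → C₀-zero ; (suc zero) → C₁-zero })
        (ℛ.nonzero-mono I ⟦ coordinates I ⟧ (proj₁ (≈ᴵ-⟦coordinates⟧ I)) I-nonzero)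
    ... | inj₂ 1∈C₀ | inj₁ C₁-zero = X≄W (ℛ.≈ᴵ-trans ⟦ 𝟙₀ ⊗ 𝟘₁ ⟧ ⟦ coordinates I ⟧ I
      (⟦⟧-cong (𝟙₀ ⊗ 𝟘₁) (coordinates I) λ
        { zero → swap (L₀.1∈⇒≈ᴵunitIdeal (coordinates I zero) 1∈C₀)
        ; (suc zero) → L₁.zeroIdeal-⊆ (coordinates I (suc zero)) , C₁-zero })
      (swap (≈ᴵ-⟦coordinates⟧ I)))

    no-walk : Walk (PIS R) X Y → ⊥
    no-walk (stop X≃Y) = L₀.unitIdeal≉zeroIdeal (1≉0 zero) (⟦⟧-injective (𝟙₀ ⊗ 𝟘₁) (𝟘₀ ⊗ 𝟙₁) X≃Y zero)
    no-walk (step {y = W} X∼W _) = X-isolated W X∼W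

  M₀-zero⇒fieldTimesLocal : ¬ NonZeroIdeal (Rs zero) M₀ → IsCactus (PIS R) → FieldTimesLocalWithOneIdeal R
  M₀-zero⇒fieldTimesLocal M₀-zero cactus with em {NonZeroIdeal (Rs (suc zero)) M₁}
  ... | no M₁-zero = ⊥-elim (¬cactus-both-fields M₀-zero M₁-zero cactus)
  ... | yes M₁-nonzero =
    Rs zero , Rs (suc zero) , C₀.maximal-zero⇒field M₀ (M-maximal zero) M₀-zero , Rs-local (suc zero) ,
    (M₁ , M-maximal (suc zero) ,
      C₁.onlyNonzeroProperIdeal M₁ (M-maximal (suc zero)) (proj₂ (proj₂ (Rs-local (suc zero)))) M₁-nonzero M₁-minimal) ,
    ≅ᴿ-trans R (Πᴿ Rs) (Rs zero ×ᴿ Rs (suc zero)) (f , f-iso) (Π₂≅× Rs)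
    where
    M₁-minimal : ∀ N → L₁._⊆_ N M₁ → NonZeroIdeal (Rs (suc zero)) N → N L₁.≈ᴵ M₁
    M₁-minimal N N⊆M₁ N-nonzero = em⇒dne em λ N≉M₁ → ¬cactus-proper-subideal N N⊆M₁ N-nonzero N≉M₁ cactus

module FieldTimesLocal {c ℓ : Level} (em : ExcludedMiddle (c ⊔ ℓ)) (R F S : CommutativeRing c ℓ)
  (F-field : IsField F) (M : Ideal S) (M-maximal : IsMaximal S M) (M-only : OnlyNonzeroProperIdeal S M)
  (R≅F×S : R ≅ᴿ (F ×ᴿ S)) where
  open RingIsomorphisms using (pair; ×≅Π₂; ≅ᴿ-trans)
  private
    R≅Π : R ≅ᴿ Πᴿ (pair F S)
    R≅Π = ≅ᴿ-trans R (F ×ᴿ S) (Πᴿ (pair F S)) R≅F×S (×≅Π₂ F S)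
  open BinaryCoordinates R (pair F S) (proj₁ R≅Π) (proj₂ R≅Π)
  open Graph (PIS R) using (V; _≃_; Adj)
  open PISProperties R
  private
    module ℛ = IdealLattice R
    module 𝔽 = IdealLattice F
    module 𝕊 = IdealLattice S
    module C𝔽 = IdealLattice.Classical F em
    module C𝕊 = IdealLattice.Classical S em
    𝟘F 𝟙F : Ideal F
    𝟘F = 𝔽.zeroIdeal
    𝟙F = 𝔽.unitIdeal
    𝟘S 𝟙S : Ideal S
    𝟘S = 𝕊.zeroIdeal
    𝟙S = 𝕊.unitIdeal
    M-nonzero : NonZeroIdeal S M
    M-nonzero = proj₁ M-only
    M-proper : Proper S M
    M-proper = proj₁ (proj₂ M-only)
    M-prime : IsPrime S M
    M-prime = C𝕊.maximal⇒prime M M-maximal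
    1≉0ᶠ : ¬ (CommutativeRing._≈_ F (CommutativeRing.1# F) (CommutativeRing.0# F))
    1≉0ᶠ = proj₁ F-field
    1≉0ˢ : ¬ (CommutativeRing._≈_ S (CommutativeRing.1# S) (CommutativeRing.0# S))
    1≉0ˢ = 𝕊.proper⇒1≉0 M M-proper

  pattern F×0 = zero
  pattern 0×M = suc zero
  pattern F×M = suc (suc zero)
  pattern 0×S = suc (suc (suc zero))

  S-ideal-trichotomy : ∀ J → J 𝕊.⊆ 𝟘S ⊎ J 𝕊.≈ᴵ M ⊎ (J ∈I) (CommutativeRing.1# S)
  S-ideal-trichotomy J with C𝕊.zero-or-nonzero J
  ... | inj₁ J-zero = inj₁ J-zero
  ... | inj₂ J-nonzero with em {(J ∈I) (CommutativeRing.1# S)}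
  ... | yes 1∈J = inj₂ (inj₂ 1∈J)
  ... | no J-proper = inj₂ (inj₁ (proj₂ (proj₂ M-only) J J-nonzero J-proper))

  rep : Fin 4 → Ideals
  rep F×0 = 𝟙F ⊗ 𝟘S
  rep 0×M = 𝟘F ⊗ M
  rep F×M = 𝟙F ⊗ M
  rep 0×S = 𝟘F ⊗ 𝟙S

  rep-nonzero : ∀ k → Σ (Fin 2) λ i → NonZeroIdeal (pair F S i) (rep k i)
  rep-nonzero F×0 = zero , 𝔽.unitIdeal-nonzero 1≉0ᶠ
  rep-nonzero 0×M = suc zero , M-nonzero
  rep-nonzero F×M = zero , 𝔽.unitIdeal-nonzero 1≉0ᶠ
  rep-nonzero 0×S = suc zero , 𝕊.unitIdeal-nonzero 1≉0ˢ

  rep-proper : ∀ k → Σ (Fin 2) λ i → Proper (pair F S i) (rep k i)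
  rep-proper F×0 = suc zero , 𝕊.zeroIdeal-proper 1≉0ˢ
  rep-proper 0×M = zero , 𝔽.zeroIdeal-proper 1≉0ᶠ
  rep-proper F×M = suc zero , M-proper
  rep-proper 0×S = zero , 𝔽.zeroIdeal-proper 1≉0ᶠ

  representative : Fin 4 → V
  representative k = vertex (rep k) (rep-nonzero k) (rep-proper k)

  𝟙F≉𝟘F : ¬ (𝟙F 𝔽.≈ᴵ 𝟘F)
  𝟙F≉𝟘F = 𝔽.unitIdeal≉zeroIdeal 1≉0ᶠ

  rep-distinct : ∀ a b → a ≢ b → Σ (Fin 2) λ i → ¬ IdealLattice._≈ᴵ_ (pair F S i) (rep a i) (rep b i)
  rep-distinct F×0 F×0 a≢a = ⊥-elim (a≢a ≡.refl)
  rep-distinct 0×M 0×M a≢a = ⊥-elim (a≢a ≡.refl)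
  rep-distinct F×M F×M a≢a = ⊥-elim (a≢a ≡.refl)
  rep-distinct 0×S 0×S a≢a = ⊥-elim (a≢a ≡.refl)
  rep-distinct F×0 0×M _ = zero , 𝟙F≉𝟘F
  rep-distinct F×0 F×M _ = suc zero , 𝕊.≉ᴵ-sym M 𝟘S (𝕊.nonzero≉zeroIdeal M M-nonzero)
  rep-distinct F×0 0×S _ = zero , 𝟙F≉𝟘F
  rep-distinct 0×M F×0 _ = zero , 𝔽.≉ᴵ-sym 𝟙F 𝟘F 𝟙F≉𝟘F
  rep-distinct 0×M F×M _ = zero , 𝔽.≉ᴵ-sym 𝟙F 𝟘F 𝟙F≉𝟘F
  rep-distinct 0×M 0×S _ = suc zero , 𝕊.≉ᴵ-sym 𝟙S M (𝕊.unitIdeal≉proper M M-proper)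
  rep-distinct F×M F×0 _ = suc zero , 𝕊.nonzero≉zeroIdeal M M-nonzero
  rep-distinct F×M 0×M _ = zero , 𝟙F≉𝟘F
  rep-distinct F×M 0×S _ = zero , 𝟙F≉𝟘F
  rep-distinct 0×S F×0 _ = zero , 𝔽.≉ᴵ-sym 𝟙F 𝟘F 𝟙F≉𝟘F
  rep-distinct 0×S 0×M _ = suc zero , 𝕊.unitIdeal≉proper M M-proper
  rep-distinct 0×S F×M _ = zero , 𝔽.≉ᴵ-sym 𝟙F 𝟘F 𝟙F≉𝟘F

  rep-injective : ∀ a b → ⟦ rep a ⟧ ℛ.≈ᴵ ⟦ rep b ⟧ → a ≡ b
  rep-injective a b ⟦a⟧≈⟦b⟧ with a Fin.≟ b
  ... | yes a≡b = a≡b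
  ... | no a≢b = let (i , ai≉bi) = rep-distinct a b a≢b in ⊥-elim (ai≉bi (⟦⟧-injective (rep a) (rep b) ⟦a⟧≈⟦b⟧ i))

  -- F has the ideals 0, F and S has the ideals 0, M, S; of the six products, 0 × 0 is not a
  -- vertex and F × S is not proper.
  classify : ∀ (W : V) → Σ (Fin 4) λ k → proj₁ W ℛ.≈ᴵ ⟦ rep k ⟧
  classify (I , I-nonzero , I-proper) = by-coordinates (C𝔽.field⇒zero-or-unit F-field (C zero)) (S-ideal-trichotomy (C (suc zero)))
    where
    C : Ideals
    C = coordinates I
    I≈⟦C⟧ : I ℛ.≈ᴵ ⟦ C ⟧
    I≈⟦C⟧ = ≈ᴵ-⟦coordinates⟧ I
    module Lᵢ (i : Fin 2) = IdealLattice (pair F S i)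
    via : ∀ k → (∀ i → Lᵢ._≈ᴵ_ i (C i) (rep k i)) → Σ (Fin 4) λ k → I ℛ.≈ᴵ ⟦ rep k ⟧
    via k C≈rep = k , ℛ.≈ᴵ-trans I ⟦ C ⟧ ⟦ rep k ⟧ I≈⟦C⟧ (⟦⟧-cong C (rep k) C≈rep)
    is-zero : ∀ i → Lᵢ._⊆_ i (C i) (Lᵢ.zeroIdeal i) → Lᵢ._≈ᴵ_ i (C i) (Lᵢ.zeroIdeal i)
    is-zero i Cᵢ⊆0 = Cᵢ⊆0 , Lᵢ.zeroIdeal-⊆ i (C i)
    is-unit : ∀ i → (C i ∈I) (CommutativeRing.1# (pair F S i)) → Lᵢ._≈ᴵ_ i (C i) (Lᵢ.unitIdeal i)
    is-unit i = Lᵢ.1∈⇒≈ᴵunitIdeal i (C i)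
    by-coordinates : C zero 𝔽.⊆ 𝟘F ⊎ (C zero ∈I) (CommutativeRing.1# F) →
      C (suc zero) 𝕊.⊆ 𝟘S ⊎ C (suc zero) 𝕊.≈ᴵ M ⊎ (C (suc zero) ∈I) (CommutativeRing.1# S) →
      Σ (Fin 4) λ k → I ℛ.≈ᴵ ⟦ rep k ⟧
    by-coordinates (inj₁ C₀-zero) (inj₁ C₁-zero) =
      ⊥-elim (⟦⟧-zero C (λ { zero → C₀-zero ; (suc zero) → C₁-zero }) (ℛ.nonzero-mono I ⟦ C ⟧ (proj₁ I≈⟦C⟧) I-nonzero))
    by-coordinates (inj₂ 1∈C₀) (inj₂ (inj₂ 1∈C₁)) =
      ⊥-elim (I-proper (proj₂ I≈⟦C⟧ _ (⟦⟧-1∈ C λ { zero → 1∈C₀ ; (suc zero) → 1∈C₁ })))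
    by-coordinates (inj₂ 1∈C₀) (inj₁ C₁-zero) = via F×0 λ { zero → is-unit zero 1∈C₀ ; (suc zero) → is-zero (suc zero) C₁-zero }
    by-coordinates (inj₁ C₀-zero) (inj₂ (inj₁ C₁≈M)) = via 0×M λ { zero → is-zero zero C₀-zero ; (suc zero) → C₁≈M }
    by-coordinates (inj₂ 1∈C₀) (inj₂ (inj₁ C₁≈M)) = via F×M λ { zero → is-unit zero 1∈C₀ ; (suc zero) → C₁≈M }
    by-coordinates (inj₁ C₀-zero) (inj₂ (inj₂ 1∈C₁)) = via 0×S λ { zero → is-zero zero C₀-zero ; (suc zero) → is-unit (suc zero) 1∈C₁ }

  class : V → Fin 4
  class W = proj₁ (classify W)

  ≈ᴵ-class : ∀ W → proj₁ W ℛ.≈ᴵ ⟦ rep (class W) ⟧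
  ≈ᴵ-class W = proj₂ (classify W)

  class-≃ : ∀ v w → v ≃ w → class v ≡ class w
  class-≃ v w v≃w = rep-injective (class v) (class w)
    (≃-trans (representative (class v)) v (representative (class w))
      (swap (≈ᴵ-class v)) (≃-trans v w (representative (class w)) v≃w (≈ᴵ-class w)))

  ≃-class : ∀ v w → class v ≡ class w → v ≃ w
  ≃-class v w class-v≡class-w = ≃-trans v (representative (class w)) w
    (≡.subst (λ k → v ≃ representative k) class-v≡class-w (≈ᴵ-class v)) (swap (≈ᴵ-class w))

  class-representative : ∀ k → class (representative k) ≡ k
  class-representative k = rep-injective (class (representative k)) k (swap (≈ᴵ-class (representative k)))

  classAdj : Fin 4 → Fin 4 → Bool
  classAdj F×0 0×M = true
  classAdj F×0 F×M = true
  classAdj 0×M F×0 = true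
  classAdj 0×M F×M = true
  classAdj 0×M 0×S = true
  classAdj F×M F×0 = true
  classAdj F×M 0×M = true
  classAdj 0×S 0×M = true
  classAdj _ _ = false

  comaximal : ∀ a b → (∀ i → ((rep a +ᶜ rep b) i ∈I) (CommutativeRing.1# (pair F S i))) →
    ¬ Adj (representative a) (representative b)
  comaximal a b = comaximal⇒¬Adj (representative a) (representative b) (rep a) (rep b) (λ _ m → m) (λ _ m → m)

  representatives-Adj : ∀ a b → Adj (representative a) (representative b) → T (classAdj a b)
  representatives-Adj F×0 F×0 (a≄a , _) = ⊥-elim (a≄a (≃-refl (representative F×0)))
  representatives-Adj 0×M 0×M (a≄a , _) = ⊥-elim (a≄a (≃-refl (representative 0×M)))
  representatives-Adj F×M F×M (a≄a , _) = ⊥-elim (a≄a (≃-refl (representative F×M)))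
  representatives-Adj 0×S 0×S (a≄a , _) = ⊥-elim (a≄a (≃-refl (representative 0×S)))
  representatives-Adj F×0 0×S = comaximal F×0 0×S λ { zero → 𝔽.1∈+ᴵˡ 𝟙F 𝟘F tt ; (suc zero) → 𝕊.1∈+ᴵʳ 𝟘S 𝟙S tt }
  representatives-Adj 0×S F×0 = comaximal 0×S F×0 λ { zero → 𝔽.1∈+ᴵʳ 𝟘F 𝟙F tt ; (suc zero) → 𝕊.1∈+ᴵˡ 𝟙S 𝟘S tt }
  representatives-Adj F×M 0×S = comaximal F×M 0×S λ { zero → 𝔽.1∈+ᴵˡ 𝟙F 𝟘F tt ; (suc zero) → 𝕊.1∈+ᴵʳ M 𝟙S tt }
  representatives-Adj 0×S F×M = comaximal 0×S F×M λ { zero → 𝔽.1∈+ᴵʳ 𝟘F 𝟙F tt ; (suc zero) → 𝕊.1∈+ᴵˡ 𝟙S M tt }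
  representatives-Adj F×0 0×M _ = _
  representatives-Adj F×0 F×M _ = _
  representatives-Adj 0×M F×0 _ = _
  representatives-Adj 0×M F×M _ = _
  representatives-Adj 0×M 0×S _ = _
  representatives-Adj F×M F×0 _ = _
  representatives-Adj F×M 0×M _ = _
  representatives-Adj 0×S 0×M _ = _


  Adj⇒classAdj : ∀ v w → Adj v w → T (classAdj (class v) (class w))
  Adj⇒classAdj v w v∼w = representatives-Adj (class v) (class w)
    (Adj-resp-≃ v (representative (class v)) w (representative (class w)) (≈ᴵ-class v) (≈ᴵ-class w) v∼w)

  hub : V
  hub = representative 0×M

  hub-Adj : ∀ k → k ≢ 0×M → Adj hub (representative k)
  hub-Adj F×0 _ = ⟦⟧-adjacent (rep 0×M) (rep F×0) (𝟙F ⊗ M)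
    (⊗-+ᶜ (𝔽.+ᴵ-identityˡ 𝟙F) (𝕊.+ᴵ-identityʳ M)) (⊗-prime₁ M M-prime) (zero , 𝔽.≉ᴵ-sym 𝟙F 𝟘F 𝟙F≉𝟘F)
  hub-Adj 0×M 0×M≢0×M = ⊥-elim (0×M≢0×M ≡.refl)
  hub-Adj F×M _ = ⟦⟧-adjacent (rep 0×M) (rep F×M) (𝟙F ⊗ M)
    (⊗-+ᶜ (𝔽.+ᴵ-identityˡ 𝟙F) (𝕊.+ᴵ-idem M)) (⊗-prime₁ M M-prime) (zero , 𝔽.≉ᴵ-sym 𝟙F 𝟘F 𝟙F≉𝟘F)
  hub-Adj 0×S _ = ⟦⟧-adjacent (rep 0×M) (rep 0×S) (𝟘F ⊗ 𝟙S)
    (⊗-+ᶜ (𝔽.+ᴵ-idem 𝟘F) (𝕊.+ᴵ-zeroʳ M)) (⊗-prime₀ 𝟘F (C𝔽.field⇒zero-prime F-field))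
    (suc zero , 𝕊.≉ᴵ-sym 𝟙S M (𝕊.unitIdeal≉proper M M-proper))

  walk-from-hub : ∀ u → class u ≡ 0×M → ∀ w → Walk (PIS R) u w
  walk-from-hub u u-in-hub w with class w Fin.≟ 0×M
  ... | yes w-in-hub = stop (≃-class u w (≡.trans u-in-hub (≡.sym w-in-hub)))
  ... | no w-off-hub = step {y = w}
    (Adj-resp-≃ hub u (representative (class w)) w (≃-class hub u (≡.trans (class-representative 0×M) (≡.sym u-in-hub)))
      (swap (≈ᴵ-class w)) (hub-Adj (class w) w-off-hub))
    (stop (≃-refl w))

  connected : Connected (PIS R)
  connected v w with class v Fin.≟ 0×M
  ... | yes v-in-hub = walk-from-hub v v-in-hub w
  ... | no v-off-hub = step {y = hub}
    (Adj-resp-≃ (representative (class v)) v hub hub (swap (≈ᴵ-class v)) (≃-refl hub)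
      (Adj-sym hub (representative (class v)) (hub-Adj (class v) v-off-hub)))
    (walk-from-hub hub (class-representative 0×M) w)

  TriangleEdge : V → V → Set
  TriangleEdge x y = class x ≢ class y × class x ≢ 0×S × class y ≢ 0×S

  -- Both facts are decided by evaluation; opaque keeps their large proof terms from being unfolded
  -- wherever they are applied.
  opaque
    class-triangle : ∀ a b c → T (classAdj a b) → T (classAdj b c) → T (classAdj c a) →
      ∀ p → (p ≢ 0×S → p ≡ a ⊎ p ≡ b ⊎ p ≡ c) × (p ≡ a ⊎ p ≡ b ⊎ p ≡ c → p ≢ 0×S)
    class-triangle = from-yes (all? λ a → all? λ b → all? λ c →
      T? (classAdj a b) →-dec T? (classAdj b c) →-dec T? (classAdj c a) →-dec all? λ p →
        (¬? (p Fin.≟ 0×S) →-dec (p Fin.≟ a ⊎-dec p Fin.≟ b ⊎-dec p Fin.≟ c)) ×-dec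
        ((p Fin.≟ a ⊎-dec p Fin.≟ b ⊎-dec p Fin.≟ c) →-dec ¬? (p Fin.≟ 0×S)))

    no-class-square : ∀ a b c d → T (classAdj a b) → T (classAdj b c) → T (classAdj c d) → T (classAdj d a) →
      a ≡ c ⊎ b ≡ d
    no-class-square = from-yes (all? λ a → all? λ b → all? λ c → all? λ d →
      T? (classAdj a b) →-dec T? (classAdj b c) →-dec T? (classAdj c d) →-dec T? (classAdj d a) →-dec
        (a Fin.≟ c ⊎-dec b Fin.≟ d))

  module Triangle (v : Fin 3 → V) (v-distinct : ∀ i j → v i ≃ v j → i ≡ j)
                  (v-adjacent : ∀ i → Adj (v i) (v (next i))) where

    corners : ∀ p → (p ≢ 0×S → p ≡ class (v zero) ⊎ p ≡ class (v (suc zero)) ⊎ p ≡ class (v (suc (suc zero)))) ×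
                    (p ≡ class (v zero) ⊎ p ≡ class (v (suc zero)) ⊎ p ≡ class (v (suc (suc zero))) → p ≢ 0×S)
    corners = class-triangle (class (v zero)) (class (v (suc zero))) (class (v (suc (suc zero))))
      (Adj⇒classAdj (v zero) (v (suc zero)) (v-adjacent zero))
      (Adj⇒classAdj (v (suc zero)) (v (suc (suc zero))) (v-adjacent (suc zero)))
      (Adj⇒classAdj (v (suc (suc zero))) (v zero) (v-adjacent (suc (suc zero))))

    corner-of : ∀ p → p ≢ 0×S → Σ (Fin 3) λ j → class (v j) ≡ p
    corner-of p p≢0×S with proj₁ (corners p) p≢0×S
    ... | inj₁ p≡ = zero , ≡.sym p≡
    ... | inj₂ (inj₁ p≡) = suc zero , ≡.sym p≡
    ... | inj₂ (inj₂ p≡) = suc (suc zero) , ≡.sym p≡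

    corner-≢0×S : ∀ j → class (v j) ≢ 0×S
    corner-≢0×S zero = proj₂ (corners (class (v zero))) (inj₁ ≡.refl)
    corner-≢0×S (suc zero) = proj₂ (corners (class (v (suc zero)))) (inj₂ (inj₁ ≡.refl))
    corner-≢0×S (suc (suc zero)) = proj₂ (corners (class (v (suc (suc zero))))) (inj₂ (inj₂ ≡.refl))

    side⇒TriangleEdge : ∀ x y j → x ≃ v j → y ≃ v (next j) → TriangleEdge x y
    side⇒TriangleEdge x y j x≃vj y≃vj′ =
      (λ cx≡cy → next-≢ j (v-distinct j (next j) (≃-class (v j) (v (next j))
        (≡.trans (≡.sym cx≡vj) (≡.trans cx≡cy cy≡vj′))))) ,
      (λ cx≡0×S → corner-≢0×S j (≡.trans (≡.sym cx≡vj) cx≡0×S)) ,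
      (λ cy≡0×S → corner-≢0×S (next j) (≡.trans (≡.sym cy≡vj′) cy≡0×S))
      where
      cx≡vj : class x ≡ class (v j)
      cx≡vj = class-≃ x (v j) x≃vj
      cy≡vj′ : class y ≡ class (v (next j))
      cy≡vj′ = class-≃ y (v (next j)) y≃vj′

    EdgeOf⇒TriangleEdge : ∀ x y → Σ (Fin 3) (λ j → (x ≃ v j × y ≃ v (next j)) ⊎ (y ≃ v j × x ≃ v (next j))) →
      TriangleEdge x y
    EdgeOf⇒TriangleEdge x y (j , inj₁ (x≃vj , y≃vj′)) = side⇒TriangleEdge x y j x≃vj y≃vj′
    EdgeOf⇒TriangleEdge x y (j , inj₂ (y≃vj , x≃vj′)) =
      let (cy≢cx , cy≢0×S , cx≢0×S) = side⇒TriangleEdge y x j y≃vj x≃vj′ in (λ e → cy≢cx (≡.sym e)) , cx≢0×S , cy≢0×S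

    TriangleEdge⇒EdgeOf : ∀ x y → TriangleEdge x y →
      Σ (Fin 3) (λ j → (x ≃ v j × y ≃ v (next j)) ⊎ (y ≃ v j × x ≃ v (next j)))
    TriangleEdge⇒EdgeOf x y (cx≢cy , cx≢0×S , cy≢0×S) with corner-of (class x) cx≢0×S | corner-of (class y) cy≢0×S
    ... | i , vi≡cx | j , vj≡cy with triangle-sides i j (λ i≡j → cx≢cy (≡.trans (≡.sym vi≡cx) (≡.trans (≡.cong (λ k → class (v k)) i≡j) vj≡cy)))
    ... | inj₁ next-i≡j = i , inj₁ (≃-class x (v i) (≡.sym vi≡cx) , ≃-class y (v (next i)) (≡.trans (≡.sym vj≡cy) (≡.cong (λ k → class (v k)) (≡.sym next-i≡j))))
    ... | inj₂ next-j≡i = j , inj₂ (≃-class y (v j) (≡.sym vj≡cy) , ≃-class x (v (next j)) (≡.trans (≡.sym vi≡cx) (≡.cong (λ k → class (v k)) (≡.sym next-j≡i))))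

  no-square : (v : Fin 4 → V) → (∀ i j → v i ≃ v j → i ≡ j) → (∀ i → Adj (v i) (v (next i))) → ⊥
  no-square v v-distinct v-adjacent with no-class-square (class (v zero)) (class (v (suc zero)))
    (class (v (suc (suc zero)))) (class (v (suc (suc (suc zero)))))
    (Adj⇒classAdj (v zero) (v (suc zero)) (v-adjacent zero))
    (Adj⇒classAdj (v (suc zero)) (v (suc (suc zero))) (v-adjacent (suc zero)))
    (Adj⇒classAdj (v (suc (suc zero))) (v (suc (suc (suc zero)))) (v-adjacent (suc (suc zero))))
    (Adj⇒classAdj (v (suc (suc (suc zero)))) (v zero) (v-adjacent (suc (suc (suc zero)))))
  ... | inj₁ c₀≡c₂ with v-distinct zero (suc (suc zero)) (≃-class (v zero) (v (suc (suc zero))) c₀≡c₂)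
  ... | ()
  no-square v v-distinct v-adjacent | inj₂ c₁≡c₃
    with v-distinct (suc zero) (suc (suc (suc zero))) (≃-class (v (suc zero)) (v (suc (suc (suc zero)))) c₁≡c₃)
  ... | ()

  no-long-cycle : ∀ k (v : Fin (5 ℕ.+ k) → V) → (∀ i j → v i ≃ v j → i ≡ j) → ⊥
  no-long-cycle k v v-distinct with pigeonhole (ℕ.m≤m+n 5 k) (λ i → class (v i))
  ... | i , j , i<j , cᵢ≡cⱼ = <-irrefl (v-distinct i j (≃-class (v i) (v j) cᵢ≡cⱼ)) i<j

  EdgeOf⇔TriangleEdge : ∀ C x y → EdgeOf (PIS R) C x y ⇔ TriangleEdge x y
  EdgeOf⇔TriangleEdge record { len = ℕ.zero ; vtx = v ; distinct = v-distinct ; adjacent = v-adjacent } x y =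
    mk⇔ (Triangle.EdgeOf⇒TriangleEdge v v-distinct v-adjacent x y) (Triangle.TriangleEdge⇒EdgeOf v v-distinct v-adjacent x y)
  EdgeOf⇔TriangleEdge record { len = ℕ.suc ℕ.zero ; vtx = v ; distinct = v-distinct ; adjacent = v-adjacent } _ _ =
    ⊥-elim (no-square v v-distinct v-adjacent)
  EdgeOf⇔TriangleEdge record { len = ℕ.suc (ℕ.suc k) ; vtx = v ; distinct = v-distinct } _ _ =
    ⊥-elim (no-long-cycle k v v-distinct)

  cactus : IsCactus (PIS R)
  cactus = connected , λ C D C≠D _ _ _ _ _ _ → ⊥-elim (C≠D λ x y →
    (λ e → Equivalence.from (EdgeOf⇔TriangleEdge D x y) (Equivalence.to (EdgeOf⇔TriangleEdge C x y) e)) ,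
    (λ e → Equivalence.from (EdgeOf⇔TriangleEdge C x y) (Equivalence.to (EdgeOf⇔TriangleEdge D x y) e)))

cactus⇒fieldTimesLocal : ∀ {c ℓ} → ExcludedMiddle (c ⊔ ℓ) → (R : CommutativeRing c ℓ) (n : ℕ) → 2 ≤ n →
  (Rs : Fin n → CommutativeRing c ℓ) → (∀ i → IsLocal (Rs i)) → R ≅ᴿ Πᴿ Rs →
  IsCactus (PIS R) → FieldTimesLocalWithOneIdeal R
cactus⇒fieldTimesLocal _ _ (ℕ.suc ℕ.zero) (ℕ.s≤s ()) _ _ _ _
cactus⇒fieldTimesLocal em R (ℕ.suc (ℕ.suc (ℕ.suc m))) _ Rs Rs-local (f , f-iso) cactus =
  ⊥-elim (ThreeOrMoreFactors.¬cactus em R m Rs Rs-local f f-iso cactus)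
cactus⇒fieldTimesLocal em R 2 _ Rs Rs-local (f , f-iso) cactus
  with em {NonZeroIdeal (Rs zero) (proj₁ (Rs-local zero))}
     | em {NonZeroIdeal (Rs (suc zero)) (proj₁ (Rs-local (suc zero)))}
... | yes M₀-nonzero | yes M₁-nonzero =
  ⊥-elim (TwoLocalFactors.¬cactus-both-nonfield em R Rs Rs-local f f-iso M₀-nonzero M₁-nonzero cactus)
... | no M₀-zero | _ = TwoLocalFactors.M₀-zero⇒fieldTimesLocal em R Rs Rs-local f f-iso M₀-zero cactus
... | yes _ | no M₁-zero =
  TwoLocalFactors.M₀-zero⇒fieldTimesLocal em R (λ i → Rs (swap₂ i)) (λ i → Rs-local (swap₂ i))
    (proj₁ R≅swapped) (proj₂ R≅swapped) M₁-zero cactus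
  where
  open RingIsomorphisms
  R≅swapped : R ≅ᴿ Πᴿ (λ i → Rs (swap₂ i))
  R≅swapped = ≅ᴿ-trans R (Πᴿ Rs) (Πᴿ (λ i → Rs (swap₂ i))) (f , f-iso) (Π₂-swap Rs)

mainTheorem4 : ∀ {c ℓ : Level} → ExcludedMiddle (Level.suc (c ⊔ ℓ)) →
  (R : CommutativeRing c ℓ) (n : ℕ) → 2 ≤ n →
  (Rs : Fin n → CommutativeRing c ℓ) → (∀ i → IsLocal (Rs i)) →
  R ≅ᴿ Πᴿ Rs →
  IsCactus (PIS R) ⇔
    (Σ (CommutativeRing c ℓ) λ F → Σ (CommutativeRing c ℓ) λ S →
       IsField F × IsLocal S
       × (Σ (Ideal S) λ M → IsMaximal S M × OnlyNonzeroProperIdeal S M)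
       × R ≅ᴿ (F ×ᴿ S))
mainTheorem4 {c} {ℓ} em R n 2≤n Rs Rs-local R≅ΠRs =
  mk⇔ (cactus⇒fieldTimesLocal em′ R n 2≤n Rs Rs-local R≅ΠRs)
      (λ (F , S , F-field , _ , (M , M-maximal , M-only) , R≅F×S) →
         FieldTimesLocal.cactus em′ R F S F-field M M-maximal M-only R≅F×S)
  where
  em′ : ExcludedMiddle (c ⊔ ℓ)
  em′ = lowerEM (Level.suc (c ⊔ ℓ)) em
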